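{- Let $p,q,r>2$ be pairwise coprime integers with $p=\min(p,q,r)$. Define $x_n,y_n$ as in the context, put $u=x_1$, $v=y_1$, \[ \mu=\min(x_q,\,x_r,\,p-x_q,\,p-x_r),\qquad C=\lfloor \mu/u\rfloor . \] Assume that $u\le\mu$ (so $C\ge1$) and that \[ q>p^2\quad\text{and}\quad v>q-q/p^2 . \] Then $\mathcal{A}_{\{p,q,r\}}\supset\{\,n\in\mathbb{Z}:|n|\le C\,\}$.
   Context: For pairwise coprime positive integers $p,q,r>2$, the polynomial \[ Q_{\{p,q,r\}}(x)=\frac{(x^{pqr}-1)(x^p-1)(x^q-1)(x^r-1)}{(x^{pq}-1)(x^{qr}-1)(x^{rp}-1)(x-1)} \] has integer coefficients, and $\mathcal{A}_{\{p,q,r\}}$ denotes its set of coefficients. Every integer $n$ has a unique representation $n=x_nqr+y_npr+z_npq+\delta_npqr$ with integers $0\le x_n<p$, $0\le y_n<q$, $0\le z_n<r$, $\delta_n\in\mathbb{Z}$; this defines $x_n,y_n$ (in particular $x_q,x_r$ for $n=q,r$). -}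

module Defs where

open import Data.Nat as ℕ using (ℕ; zero; suc; _<?_; _≤?_)
open import Data.Nat.DivMod using (_/_)
open import Data.Integer as ℤ using (ℤ; +_)
open import Data.List using (List; foldr; map; upTo)
open import Data.Product using (Σ; ∃; _×_)
open import Relation.Nullary using (yes; no)
open import Relation.Binary.PropositionalEquality using (_≡_)

Series : Set
Series = ℕ → ℤ

one : Series
one zero    = + 1
one (suc _) = + 0

mulOneMinus : ℕ → Series → Series
mulOneMinus a f k with k <? a
... | yes _ = f k
... | no  _ = f k ℤ.- f (k ℕ.∸ a)

-- division by (1 - x^b) (b ≥ 1), i.e. multiplication by Σ_{j≥0} x^{j b}
divOneMinus : ℕ → Series → Series
divOneMinus b f k = foldr ℤ._+_ (+ 0) (map term (upTo (suc k)))
  where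
  term : ℕ → ℤ
  term j with j ℕ.* b ≤? k
  ... | yes _ = f (k ℕ.∸ j ℕ.* b)
  ... | no  _ = + 0

-- Coefficients of
--   Q_{p,q,r}(x) = (x^{pqr}-1)(x^p-1)(x^q-1)(x^r-1) / ((x^{pq}-1)(x^{qr}-1)(x^{rp}-1)(x-1))
--               = (1-x^{pqr})(1-x^p)(1-x^q)(1-x^r) / ((1-x^{pq})(1-x^{qr})(1-x^{rp})(1-x))
-- computed as a power series (equal to the polynomial since the quotient is exact).
Qcoeff : ℕ → ℕ → ℕ → Series
Qcoeff p q r =
  divOneMinus 1 (divOneMinus (r ℕ.* p) (divOneMinus (q ℕ.* r) (divOneMinus (p ℕ.* q)
    (mulOneMinus (p ℕ.* q ℕ.* r) (mulOneMinus p (mulOneMinus q (mulOneMinus r one)))))))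

Qdeg : ℕ → ℕ → ℕ → ℕ
Qdeg p q r = (p ℕ.* q ℕ.* r ℕ.+ p ℕ.+ q ℕ.+ r) ℕ.∸ (p ℕ.* q ℕ.+ q ℕ.* r ℕ.+ r ℕ.* p ℕ.+ 1)

InA : ℕ → ℕ → ℕ → ℤ → Set
InA p q r n = ∃ λ k → k ℕ.≤ Qdeg p q r × Qcoeff p q r k ≡ n

IsRep : ℕ → ℕ → ℕ → ℤ → ℕ → ℕ → ℕ → ℤ → Set
IsRep p q r n x y z δ =
  x ℕ.< p × y ℕ.< q × z ℕ.< r ×
  n ≡ + (x ℕ.* (q ℕ.* r)) ℤ.+ + (y ℕ.* (p ℕ.* r)) ℤ.+ + (z ℕ.* (p ℕ.* q)) ℤ.+ δ ℤ.* + (p ℕ.* q ℕ.* r)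

-- x = x_n  and  y = y_n  (by uniqueness of the representation)
IsX : ℕ → ℕ → ℕ → ℤ → ℕ → Set
IsX p q r n x = ∃ λ y → ∃ λ z → ∃ λ δ → IsRep p q r n x y z δ

IsY : ℕ → ℕ → ℕ → ℤ → ℕ → Set
IsY p q r n y = ∃ λ x → ∃ λ z → ∃ λ δ → IsRep p q r n x y z δ

-- floor division on ℕ (the divisor 0 case is never used)
floorDiv : ℕ → ℕ → ℕ
floorDiv m zero    = 0
floorDiv m (suc k) = m / suc k

-- Below degree pqr the factor 1 - x^{pqr} of Q is invisible, so there
-- Q = (1 - x^q)(1 - x^r) W with W = (1 + x + ⋯ + x^{p-1}) F and
-- F = 1 / ((1 - x^{pq})(1 - x^{qr})(1 - x^{rp})).  For n < pqr the coefficient of x^n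
-- in F is 1 or 0 according as X·qr + Y·rp ≤ n or not, where X < p and Y < q are the
-- residues with n ≡ X·qr (mod p) and n ≡ Y·rp (mod q).  Going down one step changes
-- X by -u and Y by t = q - v, and t·p² < q; hence the p terms of a window W(b) are
-- determined by the residues of b: W(b) = m when they are (-u, q - (p-m)t) and
-- b ≥ (m-1)u·qr + (p-m), while W(b) = 0 when the X-residue is moved by ±x_q, or when
-- the Y-residue Z of b satisfies Z + p·t ≤ q and b < Z·rp.  The Chinese remainder theorem
-- then gives k < pqr at which one of W(k), W(k-r), W(k-q), W(k-q-r) equals m and the
-- others vanish, so Q(k) = ±m; whether the two windows killed by their Y-residue sit at
-- the shifts {r, q+r} or {0, q} depends on whether r·t mod q is at least q/2.  Finally Q(p) = 0, since F
-- vanishes at 1, …, p.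
module Submission where

open import Defs
open import Data.Nat as ℕ using (ℕ; zero; suc; z≤n; s≤s; _≤_; _<_; _∸_; _≤?_; _≤ᵇ_; NonZero)
import Data.Nat.Properties as ℕ
import Data.Nat.DivMod as ℕ
import Data.Nat.Divisibility as ℕ
open import Data.Nat.Coprimality using (Coprime; coprime-divisor)
import Data.Nat.Coprimality as Coprime
open import Data.Nat.Induction using (<-rec)
import Data.Nat.Tactic.RingSolver as NatSolver
open import Data.Integer as ℤ using (ℤ; +_)
import Data.Integer.Properties as ℤ
open import Data.Integer.DivMod using (_%ℕ_; _/ℕ_; a≡a%ℕn+[a/ℕn]*n; n%ℕd<d)
open import Data.Integer.Divisibility.Signed
  using (_∣_; divides; ∣ᵤ⇒∣; ∣⇒∣ᵤ; ∣-trans; ∣-refl; ∣m∣n⇒∣m+n; ∣m∣n⇒∣m-n; ∣m⇒∣-m; ∣n⇒∣m*n; module ∣-Reasoning)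
open import Data.Integer.Tactic.RingSolver using (solve-∀)
open import Data.List using (List; []; _∷_; foldr; map; applyUpTo)
open import Data.Product using (Σ; _×_; _,_; proj₁; proj₂)
open import Function using (_$_; _∘′_)
open import Relation.Binary.PropositionalEquality
open import Relation.Nullary using (yes; no; ¬_; Dec; contradiction)
open import Relation.Nullary.Decidable using (T?)

module PowerSeries where

  open import Data.Integer using (_+_; _-_)

  shift : ℕ → Series → Series
  shift b f k with b ≤? k
  ... | yes _ = f (k ∸ b)
  ... | no  _ = + 0

  shift-≤ : ∀ {b k} f → b ≤ k → shift b f k ≡ f (k ∸ b)
  shift-≤ {b} {k} f b≤k with b ≤? k
  ... | yes _   = refl
  ... | no  b≰k = contradiction b≤k b≰k

  shift-> : ∀ {b k} f → k < b → shift b f k ≡ + 0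
  shift-> {b} {k} f k<b with b ≤? k
  ... | yes b≤k = contradiction b≤k (ℕ.<⇒≱ k<b)
  ... | no  _   = refl

  shift-vanishes : ∀ {b k} f → (b ≤ k → f (k ∸ b) ≡ + 0) → shift b f k ≡ + 0
  shift-vanishes {b} {k} f f≡0 with b ≤? k
  ... | yes b≤k = f≡0 b≤k
  ... | no  _   = refl

  shift-zero : ∀ f → shift 0 f ≗ f
  shift-zero f k = shift-≤ f z≤n

  shift-cong : ∀ b {f g} k → (∀ j → j ≤ k → f j ≡ g j) → shift b f k ≡ shift b g k
  shift-cong b k f≡g with b ≤? k
  ... | yes _ = f≡g (k ∸ b) (ℕ.m∸n≤m k b)
  ... | no  _ = refl

  shift-cong< : ∀ {b} {f g} k → 1 ≤ b → (∀ j → j < k → f j ≡ g j) → shift b f k ≡ shift b g k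
  shift-cong< {b} k 1≤b f≡g with b ≤? k
  ... | yes b≤k = f≡g (k ∸ b) (ℕ.∸-monoʳ-< 1≤b b≤k)
  ... | no  _   = refl

  shift-+ : ∀ b f g k → shift b (λ j → f j + g j) k ≡ shift b f k + shift b g k
  shift-+ b f g k with b ≤? k
  ... | yes _ = refl
  ... | no  _ = refl

  shift-sub : ∀ b f g k → shift b (λ j → f j - g j) k ≡ shift b f k - shift b g k
  shift-sub b f g k with b ≤? k
  ... | yes _ = refl
  ... | no  _ = refl

  shift-shift : ∀ a b f k → shift a (shift b f) k ≡ shift (a ℕ.+ b) f k
  shift-shift a b f k with a ≤? k | (a ℕ.+ b) ≤? k
  ... | yes a≤k | yes a+b≤k =
    trans (shift-≤ f (ℕ.m+n≤o⇒m≤o∸n b (subst (_≤ k) (ℕ.+-comm a b) a+b≤k)))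
          (cong f (ℕ.∸-+-assoc k a b))
  ... | yes a≤k | no  a+b≰k =
    shift-> f (ℕ.≰⇒> λ b≤k∸a → a+b≰k (subst (_≤ k) (ℕ.+-comm b a) (ℕ.m≤o∸n⇒m+n≤o b a≤k b≤k∸a)))
  ... | no  a≰k | yes a+b≤k = contradiction (ℕ.m+n≤o⇒m≤o a a+b≤k) a≰k
  ... | no  _   | no  _     = refl

  shift-comm : ∀ a b f k → shift a (shift b f) k ≡ shift b (shift a f) k
  shift-comm a b f k =
    trans (shift-shift a b f k) (trans (cong (λ c → shift c f k) (ℕ.+-comm a b)) (sym (shift-shift b a f k)))

  Σ< : ℕ → (ℕ → ℤ) → ℤ
  Σ< zero    g = + 0
  Σ< (suc n) g = g 0 + Σ< n (g ∘′ suc)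

  Σ<-cong : ∀ n {g h} → (∀ j → j < n → g j ≡ h j) → Σ< n g ≡ Σ< n h
  Σ<-cong zero    g≡h = refl
  Σ<-cong (suc n) g≡h = cong₂ _+_ (g≡h 0 (s≤s z≤n)) (Σ<-cong n λ j j<n → g≡h (suc j) (s≤s j<n))

  Σ<-zero : ∀ n {g} → (∀ j → j < n → g j ≡ + 0) → Σ< n g ≡ + 0
  Σ<-zero zero    g≡0 = refl
  Σ<-zero (suc n) g≡0 = cong₂ _+_ (g≡0 0 (s≤s z≤n)) (Σ<-zero n λ j j<n → g≡0 (suc j) (s≤s j<n))

  Σ<-suc : ∀ n g → Σ< (suc n) g ≡ Σ< n g + g n
  Σ<-suc zero    g = trans (ℤ.+-identityʳ (g 0)) (sym (ℤ.+-identityˡ (g 0)))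
  Σ<-suc (suc n) g = trans (cong (λ s → g 0 + s) (Σ<-suc n (g ∘′ suc))) (sym (ℤ.+-assoc (g 0) _ _))

  Σ<-truncate : ∀ {n N g} → n ≤ N → (∀ j → n ≤ j → j < N → g j ≡ + 0) → Σ< N g ≡ Σ< n g
  Σ<-truncate {zero}          _         g≡0 = Σ<-zero _ λ j j<N → g≡0 j z≤n j<N
  Σ<-truncate {suc n} {suc N} {g} (s≤s n≤N) g≡0 =
    cong (λ s → g 0 + s) (Σ<-truncate n≤N λ j n≤j j<N → g≡0 (suc j) (s≤s n≤j) (s≤s j<N))

  Σ<-indicator : ∀ a N g → (∀ i → i < N → i < a → g i ≡ + 0) → (∀ i → i < N → a ≤ i → g i ≡ + 1) →
                 Σ< N g ≡ + (N ∸ a)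
  Σ<-indicator a zero    g g≡0 g≡1 = cong +_ (sym (ℕ.0∸n≡0 a))
  Σ<-indicator a (suc N) g g≡0 g≡1 = begin
    Σ< (suc N) g         ≡⟨ Σ<-suc N g ⟩
    Σ< N g + g N         ≡⟨ cong (_+ g N) (Σ<-indicator a N g (λ i → g≡0 i ∘′ ℕ.m<n⇒m<1+n) (λ i → g≡1 i ∘′ ℕ.m<n⇒m<1+n)) ⟩
    + (N ∸ a) + g N      ≡⟨ last (N ℕ.<? a) ⟩
    + (suc N ∸ a)        ∎
    where
    open ≡-Reasoning
    last : Dec (N < a) → + (N ∸ a) + g N ≡ + (suc N ∸ a)
    last (yes N<a) = begin
      + (N ∸ a) + g N   ≡⟨ cong₂ _+_ (cong +_ (ℕ.m≤n⇒m∸n≡0 (ℕ.<⇒≤ N<a))) (g≡0 N ℕ.≤-refl N<a) ⟩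
      + 0               ≡⟨ cong +_ (sym (ℕ.m≤n⇒m∸n≡0 N<a)) ⟩
      + (suc N ∸ a)     ∎
    last (no N≮a) = begin
      + (N ∸ a) + g N   ≡⟨ cong (λ s → + (N ∸ a) + s) (g≡1 N ℕ.≤-refl (ℕ.≮⇒≥ N≮a)) ⟩
      + (N ∸ a ℕ.+ 1)   ≡⟨ cong +_ (ℕ.+-comm (N ∸ a) 1) ⟩
      + (suc (N ∸ a))   ≡⟨ cong +_ (sym (ℕ.+-∸-assoc 1 (ℕ.≮⇒≥ N≮a))) ⟩
      + (suc N ∸ a)     ∎

  Σ<-foldr : ∀ (g : ℕ → ℤ) h n → foldr _+_ (+ 0) (map g (applyUpTo h n)) ≡ Σ< n (λ j → g (h j))
  Σ<-foldr g h zero    = refl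
  Σ<-foldr g h (suc n) = cong (λ s → g (h 0) + s) (Σ<-foldr g (h ∘′ suc) n)

  -- The summand of divOneMinus is local to Defs; it is recovered as the witness of a Σ-type.
  private
    summand : ∀ b f k → Σ (ℕ → ℤ) λ term →
              divOneMinus b f k ≡ f (k ∸ 0 ℕ.* b) + foldr _+_ (+ 0) (map term (applyUpTo suc k))
    summand b f k = _ , refl

    summand≡shift : ∀ b f k j → proj₁ (summand b f k) j ≡ shift (j ℕ.* b) f k
    summand≡shift b f k j with T? (j ℕ.* b ≤ᵇ k)
    ... | yes _ = refl
    ... | no  _ = refl

  divOneMinus-Σ< : ∀ b f k → divOneMinus b f k ≡ Σ< (suc k) (λ j → shift (j ℕ.* b) f k)
  divOneMinus-Σ< b f k =
    trans (proj₂ (summand b f k))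
          (cong₂ _+_ (sym (shift-zero f k))
                     (trans (Σ<-foldr _ suc k) (Σ<-cong k λ j _ → summand≡shift b f k (suc j))))

  divOneMinus-rec : ∀ {b} f k → 1 ≤ b → divOneMinus b f k ≡ f k + shift b (divOneMinus b f) k
  divOneMinus-rec {b} f k 1≤b = begin
    divOneMinus b f k                               ≡⟨ divOneMinus-Σ< b f k ⟩
    shift 0 f k + Σ< k (λ j → shift (suc j ℕ.* b) f k) ≡⟨ cong₂ _+_ (shift-zero f k) (tail (b ≤? k)) ⟩
    f k + shift b D k                               ∎
    where
    open ≡-Reasoning
    instance _ = ℕ.>-nonZero 1≤b
    D = divOneMinus b f
    tail : Dec (b ≤ k) → Σ< k (λ j → shift (suc j ℕ.* b) f k) ≡ shift b D k
    tail (no b≰k) = trans (Σ<-zero k λ j _ → shift-> f (ℕ.<-≤-trans (ℕ.≰⇒> b≰k) (ℕ.m≤m+n b _)))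
                          (sym (shift-> D (ℕ.≰⇒> b≰k)))
    tail (yes b≤k) = begin
      Σ< k (λ j → shift (suc j ℕ.* b) f k)    ≡⟨ Σ<-cong k (λ j _ → trans (sym (shift-shift b (j ℕ.* b) f k)) (shift-≤ _ b≤k)) ⟩
      Σ< k (λ j → shift (j ℕ.* b) f (k ∸ b))  ≡⟨ Σ<-truncate (ℕ.∸-monoʳ-< 1≤b b≤k) (λ j k∸b<j _ → shift-> f (ℕ.<-≤-trans k∸b<j (ℕ.m≤m*n j b))) ⟩
      Σ< (suc (k ∸ b)) (λ j → shift (j ℕ.* b) f (k ∸ b)) ≡⟨ sym (divOneMinus-Σ< b f (k ∸ b)) ⟩
      D (k ∸ b)                               ≡⟨ sym (shift-≤ D b≤k) ⟩
      shift b D k                             ∎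

  mulOneMinus-shift : ∀ a f k → mulOneMinus a f k ≡ f k - shift a f k
  mulOneMinus-shift a f k with k ℕ.<? a
  ... | yes k<a = sym (trans (cong (f k -_) (shift-> f k<a)) (ℤ.+-identityʳ (f k)))
  ... | no  k≮a = cong (f k -_) (sym (shift-≤ f (ℕ.≮⇒≥ k≮a)))

  mulOneMinus-below : ∀ {a k} f → k < a → mulOneMinus a f k ≡ f k
  mulOneMinus-below {a} {k} f k<a = trans (mulOneMinus-shift a f k)
    (trans (cong (f k -_) (shift-> f k<a)) (ℤ.+-identityʳ (f k)))

  shift-rec-unique : ∀ {b} (f : Series) {G H : Series} → 1 ≤ b →
                     (∀ k → G k ≡ f k + shift b G k) → (∀ k → H k ≡ f k + shift b H k) → G ≗ H
  shift-rec-unique {b} f {G} {H} 1≤b G-rec H-rec = <-rec (λ k → G k ≡ H k) λ k ih → begin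
    G k               ≡⟨ G-rec k ⟩
    f k + shift b G k ≡⟨ cong (λ s → f k + s) (shift-cong< k 1≤b λ j j<k → ih j<k) ⟩
    f k + shift b H k ≡⟨ sym (H-rec k) ⟩
    H k               ∎
    where open ≡-Reasoning

  divOneMinus-cong : ∀ {b f g} → 1 ≤ b → f ≗ g → divOneMinus b f ≗ divOneMinus b g
  divOneMinus-cong {b} {f} {g} 1≤b f≗g = shift-rec-unique g 1≤b
    (λ k → trans (divOneMinus-rec f k 1≤b) (cong (_+ shift b (divOneMinus b f) k) (f≗g k))) (λ k → divOneMinus-rec g k 1≤b)

  mulOneMinus-cong : ∀ a {f g} → f ≗ g → mulOneMinus a f ≗ mulOneMinus a g
  mulOneMinus-cong a {f} {g} f≗g k = begin
    mulOneMinus a f k   ≡⟨ mulOneMinus-shift a f k ⟩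
    f k - shift a f k   ≡⟨ cong₂ _-_ (f≗g k) (shift-cong a k λ j _ → f≗g j) ⟩
    g k - shift a g k   ≡⟨ sym (mulOneMinus-shift a g k) ⟩
    mulOneMinus a g k   ∎
    where open ≡-Reasoning

  mulOneMinus-comm : ∀ a b f → mulOneMinus a (mulOneMinus b f) ≗ mulOneMinus b (mulOneMinus a f)
  mulOneMinus-comm a b f k = begin
    mulOneMinus a (mulOneMinus b f) k                         ≡⟨ expand a b ⟩
    (f k - shift b f k) - (shift a f k - shift a (shift b f) k) ≡⟨ cong (λ s → (f k - shift b f k) - (shift a f k - s)) (shift-comm a b f k) ⟩
    (f k - shift b f k) - (shift a f k - shift b (shift a f) k) ≡⟨ swap (f k) (shift b f k) (shift a f k) _ ⟩
    (f k - shift a f k) - (shift b f k - shift b (shift a f) k) ≡⟨ sym (expand b a) ⟩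
    mulOneMinus b (mulOneMinus a f) k                         ∎
    where
    open ≡-Reasoning
    expand : ∀ a b → mulOneMinus a (mulOneMinus b f) k ≡ (f k - shift b f k) - (shift a f k - shift a (shift b f) k)
    expand a b = trans (mulOneMinus-shift a _ k)
      (cong₂ _-_ (mulOneMinus-shift b f k)
                 (trans (shift-cong a k λ j _ → mulOneMinus-shift b f j) (shift-sub a f (shift b f) k)))
    swap : ∀ x y z w → (x - y) - (z - w) ≡ (x - z) - (y - w)
    swap = solve-∀

  mulOneMinus-divOneMinus : ∀ a {b} f → 1 ≤ b → mulOneMinus a (divOneMinus b f) ≗ divOneMinus b (mulOneMinus a f)
  mulOneMinus-divOneMinus a {b} f 1≤b = shift-rec-unique (mulOneMinus a f) 1≤b G-rec
    (λ k → divOneMinus-rec (mulOneMinus a f) k 1≤b)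
    where
    D = divOneMinus b f
    G = mulOneMinus a D
    G-rec : ∀ k → G k ≡ mulOneMinus a f k + shift b G k
    G-rec k = begin
      G k                                                  ≡⟨ mulOneMinus-shift a D k ⟩
      D k - shift a D k                                    ≡⟨ cong₂ _-_ (divOneMinus-rec f k 1≤b)
                                                              (trans (shift-cong a k λ j _ → divOneMinus-rec f j 1≤b) (shift-+ a f (shift b D) k)) ⟩
      (f k + shift b D k) - (shift a f k + shift a (shift b D) k) ≡⟨ cong (λ s → (f k + shift b D k) - (shift a f k + s)) (shift-comm a b D k) ⟩
      (f k + shift b D k) - (shift a f k + shift b (shift a D) k) ≡⟨ regroup (f k) (shift b D k) (shift a f k) _ ⟩
      (f k - shift a f k) + (shift b D k - shift b (shift a D) k) ≡⟨ cong₂ _+_ (sym (mulOneMinus-shift a f k)) (sym (shift-sub b D (shift a D) k)) ⟩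
      mulOneMinus a f k + shift b (λ j → D j - shift a D j) k
        ≡⟨ cong (λ s → mulOneMinus a f k + s) (shift-cong b k λ j _ → sym (mulOneMinus-shift a D j)) ⟩
      mulOneMinus a f k + shift b G k                      ∎
      where
      open ≡-Reasoning
      regroup : ∀ x y z w → (x + y) - (z + w) ≡ (x - z) + (y - w)
      regroup = solve-∀

  mulOneMinus-divOneMinus1 : ∀ n F k → mulOneMinus n (divOneMinus 1 F) k ≡ Σ< n (λ i → shift i F k)
  mulOneMinus-divOneMinus1 n F k = trans (mulOneMinus-shift n D k) (telescope n)
    where
    open ≡-Reasoning
    D = divOneMinus 1 F
    telescope : ∀ n → D k - shift n D k ≡ Σ< n (λ i → shift i F k)
    telescope zero = trans (cong (D k -_) (shift-zero D k)) (ℤ.+-inverseʳ (D k))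
    telescope (suc n) = begin
      D k - shift (suc n) D k
        ≡⟨ cong (D k -_) (trans (sym (trans (shift-shift n 1 D k) (cong (λ c → shift c D k) (ℕ.+-comm n 1)))) step) ⟩
      D k - (shift n D k - shift n F k)        ≡⟨ rearrange (D k) (shift n D k) (shift n F k) ⟩
      (D k - shift n D k) + shift n F k        ≡⟨ cong (_+ shift n F k) (telescope n) ⟩
      Σ< n (λ i → shift i F k) + shift n F k   ≡⟨ sym (Σ<-suc n _) ⟩
      Σ< (suc n) (λ i → shift i F k)           ∎
      where
      cancel : ∀ x y → (x + y) - x ≡ y
      cancel = solve-∀
      step : shift n (shift 1 D) k ≡ shift n D k - shift n F k
      step = sym (trans (cong (_- shift n F k) (trans (shift-cong n k λ j _ → divOneMinus-rec F j ℕ.≤-refl) (shift-+ n F (shift 1 D) k)))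
                        (cancel (shift n F k) (shift n (shift 1 D) k)))
      rearrange : ∀ x y z → x - (y - z) ≡ (x - y) + z
      rearrange = solve-∀

  mulOneMinus* : List ℕ → Series → Series
  mulOneMinus* as f = foldr mulOneMinus f as

  divOneMinus-mulOneMinus* : ∀ {b} as f → 1 ≤ b → divOneMinus b (mulOneMinus* as f) ≗ mulOneMinus* as (divOneMinus b f)
  divOneMinus-mulOneMinus* []       f 1≤b k = refl
  divOneMinus-mulOneMinus* (a ∷ as) f 1≤b k =
    trans (sym (mulOneMinus-divOneMinus a (mulOneMinus* as f) 1≤b k))
          (mulOneMinus-cong a (divOneMinus-mulOneMinus* as f 1≤b) k)

  F : ℕ → ℕ → ℕ → Series
  F p q r = divOneMinus (r ℕ.* p) (divOneMinus (q ℕ.* r) (divOneMinus (p ℕ.* q) one))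

  W : ℕ → ℕ → ℕ → Series
  W p q r k = Σ< p (λ i → shift i (F p q r) k)

  Qcoeff-W : ∀ p q r k → 1 ≤ p → 1 ≤ q → 1 ≤ r → k < p ℕ.* q ℕ.* r →
             Qcoeff p q r k ≡ (W p q r k - shift r (W p q r) k) - (shift q (W p q r) k - shift (q ℕ.+ r) (W p q r) k)
  Qcoeff-W p q r k 1≤p 1≤q 1≤r k<pqr = begin
    Qcoeff p q r k                                  ≡⟨ divisions-inward k ⟩
    mulOneMinus* numerator (divOneMinus 1 Fs) k     ≡⟨ mulOneMinus-below _ k<pqr ⟩
    mulOneMinus p (mulOneMinus q (mulOneMinus r D)) k ≡⟨ mulOneMinus-comm p q _ k ⟩
    mulOneMinus q (mulOneMinus p (mulOneMinus r D)) k ≡⟨ mulOneMinus-cong q (λ j → trans (mulOneMinus-comm p r D j)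
                                                         (mulOneMinus-cong r (mulOneMinus-divOneMinus1 p Fs) j)) k ⟩
    mulOneMinus q (mulOneMinus r Wp) k              ≡⟨ mulOneMinus-shift q _ k ⟩
    mulOneMinus r Wp k - shift q (mulOneMinus r Wp) k ≡⟨ cong₂ _-_ (mulOneMinus-shift r Wp k)
                                                         (trans (shift-cong q k λ j _ → mulOneMinus-shift r Wp j) (shift-sub q Wp (shift r Wp) k)) ⟩
    (Wp k - shift r Wp k) - (shift q Wp k - shift q (shift r Wp) k)
      ≡⟨ cong (λ s → (Wp k - shift r Wp k) - (shift q Wp k - s)) (shift-shift q r Wp k) ⟩
    (Wp k - shift r Wp k) - (shift q Wp k - shift (q ℕ.+ r) Wp k) ∎
    where
    open ≡-Reasoning
    Fs = F p q r
    D  = divOneMinus 1 Fs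
    Wp = W p q r
    numerator = p ℕ.* q ℕ.* r ∷ p ∷ q ∷ r ∷ []
    divisions-inward : Qcoeff p q r ≗ mulOneMinus* numerator D
    divisions-inward j = begin
      Qcoeff p q r j ≡⟨ divOneMinus-cong ℕ.≤-refl (λ j → trans (divOneMinus-cong 1≤rp (λ j → trans
                          (divOneMinus-cong 1≤qr (divOneMinus-mulOneMinus* numerator one 1≤pq) j)
                          (divOneMinus-mulOneMinus* numerator _ 1≤qr j)) j)
                          (divOneMinus-mulOneMinus* numerator _ 1≤rp j)) j ⟩
      divOneMinus 1 (mulOneMinus* numerator Fs) j ≡⟨ divOneMinus-mulOneMinus* numerator Fs ℕ.≤-refl j ⟩
      mulOneMinus* numerator D j ∎
      where
      1≤pq = ℕ.*-mono-≤ 1≤p 1≤q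
      1≤qr = ℕ.*-mono-≤ 1≤q 1≤r
      1≤rp = ℕ.*-mono-≤ 1≤r 1≤p

  divOneMinus-vanishes : ∀ {b d} {f : Series} → 1 ≤ b → d ℕ.∣ b → (∀ m → ¬ d ℕ.∣ m → f m ≡ + 0) →
                         ∀ m → ¬ d ℕ.∣ m → divOneMinus b f m ≡ + 0
  divOneMinus-vanishes {b} {d} {f} 1≤b d∣b f≡0 = <-rec _ λ m ih d∤m → begin
    divOneMinus b f m                 ≡⟨ divOneMinus-rec f m 1≤b ⟩
    f m + shift b (divOneMinus b f) m ≡⟨ cong₂ _+_ (f≡0 m d∤m) (shift-vanishes _ λ b≤m →
                                          ih (ℕ.∸-monoʳ-< 1≤b b≤m) λ d∣m∸b → d∤m (ℕ.∣m∸n∣n⇒∣m d b≤m d∣m∸b d∣b)) ⟩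
    + 0                               ∎
    where open ≡-Reasoning

  divOneMinus-one-∤ : ∀ {b} → 1 ≤ b → ∀ m → ¬ b ℕ.∣ m → divOneMinus b one m ≡ + 0
  divOneMinus-one-∤ 1≤b = divOneMinus-vanishes 1≤b ℕ.∣-refl one-∤
    where
    one-∤ : ∀ m → ¬ _ ℕ.∣ m → one m ≡ + 0
    one-∤ zero    b∤0 = contradiction (_ ℕ.∣0) b∤0
    one-∤ (suc m) _   = refl

  divOneMinus-one-∣ : ∀ {b} → 1 ≤ b → ∀ m → b ℕ.∣ m → divOneMinus b one m ≡ + 1
  divOneMinus-one-∣ {b} 1≤b _ (ℕ.divides c refl) = multiple c
    where
    multiple : ∀ c → divOneMinus b one (c ℕ.* b) ≡ + 1
    multiple zero    = trans (divOneMinus-rec one 0 1≤b) (cong (λ s → + 1 + s) (shift-> _ 1≤b))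
    multiple (suc c) = trans (divOneMinus-rec one (b ℕ.+ c ℕ.* b) 1≤b)
      (cong₂ _+_ (one-pos (ℕ.≤-trans 1≤b (ℕ.m≤m+n b _)))
                 (trans (shift-≤ _ (ℕ.m≤m+n b _)) (trans (cong (divOneMinus b one) (ℕ.m+n∸m≡n b _)) (multiple c))))
      where
      one-pos : ∀ {m} → 1 ≤ m → one m ≡ + 0
      one-pos (s≤s _) = refl

open PowerSeries

module Congruences where

  open import Data.Integer using (_+_; _-_; _*_; -_)


  infix 4 _≡_mod_

  record _≡_mod_ (a b : ℤ) (n : ℕ) : Set where
    constructor ≡mod
    field ∣-difference : + n ∣ a - b

  mod-reflexive : ∀ {a b n} → a ≡ b → a ≡ b mod n
  mod-reflexive {a} refl = ≡mod (divides (+ 0) (ℤ.+-inverseʳ a))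

  mod-sym : ∀ {a b n} → a ≡ b mod n → b ≡ a mod n
  mod-sym {a} {b} (≡mod a≡b) = ≡mod $ begin
    _           ∣⟨ ∣m⇒∣-m a≡b ⟩
    - (a - b)   ≡⟨ flip a b ⟩
    b - a       ∎
    where
    open ∣-Reasoning
    flip : ∀ a b → - (a - b) ≡ b - a
    flip = solve-∀

  mod-trans : ∀ {a b c n} → a ≡ b mod n → b ≡ c mod n → a ≡ c mod n
  mod-trans {a} {b} {c} (≡mod a≡b) (≡mod b≡c) = ≡mod $ begin
    _                 ∣⟨ ∣m∣n⇒∣m+n a≡b b≡c ⟩
    (a - b) + (b - c) ≡⟨ chain a b c ⟩
    a - c             ∎
    where
    open ∣-Reasoning
    chain : ∀ a b c → (a - b) + (b - c) ≡ a - c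
    chain = solve-∀

  mod-respˡ : ∀ {a b c n} → a ≡ c → a ≡ b mod n → c ≡ b mod n
  mod-respˡ refl a≡b = a≡b

  mod-respʳ : ∀ {a b c n} → b ≡ c → a ≡ b mod n → a ≡ c mod n
  mod-respʳ refl a≡b = a≡b

  mod-+ : ∀ {a b c d n} → a ≡ b mod n → c ≡ d mod n → a + c ≡ b + d mod n
  mod-+ {a} {b} {c} {d} (≡mod a≡b) (≡mod c≡d) = ≡mod $ begin
    _                 ∣⟨ ∣m∣n⇒∣m+n a≡b c≡d ⟩
    (a - b) + (c - d) ≡⟨ regroup a b c d ⟩
    (a + c) - (b + d) ∎
    where
    open ∣-Reasoning
    regroup : ∀ a b c d → (a - b) + (c - d) ≡ (a + c) - (b + d)
    regroup = solve-∀

  mod-sub : ∀ {a b c d n} → a ≡ b mod n → c ≡ d mod n → a - c ≡ b - d mod n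
  mod-sub {a} {b} {c} {d} (≡mod a≡b) (≡mod c≡d) = ≡mod $ begin
    _                 ∣⟨ ∣m∣n⇒∣m-n a≡b c≡d ⟩
    (a - b) - (c - d) ≡⟨ regroup a b c d ⟩
    (a - c) - (b - d) ∎
    where
    open ∣-Reasoning
    regroup : ∀ a b c d → (a - b) - (c - d) ≡ (a - c) - (b - d)
    regroup = solve-∀

  mod-* : ∀ c {a b n} → a ≡ b mod n → c * a ≡ c * b mod n
  mod-* c {a} {b} (≡mod a≡b) = ≡mod $ begin
    _           ∣⟨ ∣n⇒∣m*n c a≡b ⟩
    c * (a - b) ≡⟨ distrib c a b ⟩
    c * a - c * b ∎
    where
    open ∣-Reasoning
    distrib : ∀ c a b → c * (a - b) ≡ c * a - c * b
    distrib = solve-∀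

  mod-*ʳ : ∀ c {a b n} → a ≡ b mod n → a * c ≡ b * c mod n
  mod-*ʳ c {a} {b} a≡b = mod-respˡ (ℤ.*-comm c a) (mod-respʳ (ℤ.*-comm c b) (mod-* c a≡b))

  multiple-mod0 : ∀ c n → c * + n ≡ + 0 mod n
  multiple-mod0 c n = ≡mod (divides c (ℤ.+-identityʳ (c * + n)))

  n+-mod : ∀ n y → + (n ℕ.+ y) ≡ + y mod n
  n+-mod n y = ≡mod (divides (+ 1) (trans (cong (_- + y) (ℤ.pos-+ n y)) (cancel (+ n) (+ y))))
    where
    cancel : ∀ n y → (n + y) - y ≡ + 1 * n
    cancel = solve-∀

  -multiple-mod : ∀ x c n → x - c * + n ≡ x mod n
  -multiple-mod x c n = ≡mod (divides (ℤ.- c) (cancel x c (+ n)))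
    where
    cancel : ∀ x c n → (x - c * n) - x ≡ ℤ.- c * n
    cancel = solve-∀

  mod-∣ : ∀ {a b d n} → d ℕ.∣ n → a ≡ b mod n → a ≡ b mod d
  mod-∣ d∣n (≡mod n∣a-b) = ≡mod (∣-trans (∣ᵤ⇒∣ d∣n) n∣a-b)

  mod0⇒∣ : ∀ {m n} → + m ≡ + 0 mod n → n ℕ.∣ m
  mod0⇒∣ {m} {n} (≡mod n∣m) = ∣⇒∣ᵤ (subst (+ n ∣_) (ℤ.+-identityʳ (+ m)) n∣m)

  ∣⇒mod0 : ∀ {m n} → n ℕ.∣ m → + m ≡ + 0 mod n
  ∣⇒mod0 {m} {n} n∣m = ≡mod (subst (+ n ∣_) (sym (ℤ.+-identityʳ (+ m))) (∣ᵤ⇒∣ n∣m))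

  %ℕ-mod : ∀ a n .{{_ : NonZero n}} → a ≡ + (a %ℕ n) mod n
  %ℕ-mod a n = ≡mod $ divides (a /ℕ n) (quot a (+ (a %ℕ n)) (a≡a%ℕn+[a/ℕn]*n a n))
    where
    quot : ∀ a r → a ≡ r + (a /ℕ n) * + n → a - r ≡ (a /ℕ n) * + n
    quot a r a≡ = trans (cong (_- r) a≡) (cancel r ((a /ℕ n) * + n))
      where
      cancel : ∀ r s → (r + s) - r ≡ s
      cancel = solve-∀

  mod-representative : ∀ base T n .{{_ : NonZero n}} →
                       Σ ℕ λ k → base ≤ k × k < base ℕ.+ n × + k ≡ T mod n
  mod-representative base T n =
    base ℕ.+ e , ℕ.m≤m+n base e , ℕ.+-monoʳ-< base (n%ℕd<d (T - + base) n) ,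
    mod-respʳ (cancel (+ base) T) (mod-+ (mod-reflexive {b = + base} refl) (mod-sym (%ℕ-mod (T - + base) n)))
    where
    e = (T - + base) %ℕ n
    cancel : ∀ b T → b + (T - b) ≡ T
    cancel = solve-∀



  pos-∸ : ∀ {m n} → n ≤ m → + (m ∸ n) ≡ + m - + n
  pos-∸ {m} {n} n≤m = sym (trans (ℤ.m-n≡m⊖n m n) (ℤ.⊖-≥ n≤m))

  mod-∸ : ∀ {a b x y n} → b ≤ a → + a ≡ x mod n → + b ≡ y mod n → + (a ∸ b) ≡ x - y mod n
  mod-∸ b≤a a≡x b≡y = mod-respˡ (sym (pos-∸ b≤a)) (mod-sub a≡x b≡y)

  mod-∸-∣ : ∀ {m K x n} → K ≤ m → n ℕ.∣ K → + m ≡ x mod n → + (m ∸ K) ≡ x mod n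
  mod-∸-∣ {x = x} K≤m n∣K m≡x = mod-respʳ (ℤ.+-identityʳ x) (mod-∸ K≤m m≡x (∣⇒mod0 n∣K))

  mod-∸-suc : ∀ X {m K n} → K ≤ m → + m ≡ + suc X * + K mod n → + (m ∸ K) ≡ + X * + K mod n
  mod-∸-suc X {K = K} K≤m m≡ =
    mod-respʳ (drop-one (+ X) (+ K)) (mod-∸ K≤m m≡ (mod-reflexive (sym (ℤ.*-identityˡ (+ K)))))
    where
    drop-one : ∀ x k → (+ 1 + x) * k - + 1 * k ≡ x * k
    drop-one = solve-∀

  mod-∸-* : ∀ {n K k s} a b → s ≤ k → + k ≡ a * + K mod n → + s ≡ b * + K mod n → + (k ∸ s) ≡ (a - b) * + K mod n
  mod-∸-* {K = K} a b s≤k k≡aK s≡bK = mod-respʳ (factor a b (+ K)) (mod-∸ s≤k k≡aK s≡bK)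
    where
    factor : ∀ a b k → a * k - b * k ≡ (a - b) * k
    factor = solve-∀

  ∣⇒mod-∸-pred : ∀ {m K n} → 1 ≤ n → K ≤ m → n ℕ.∣ m → + (m ∸ K) ≡ + (n ∸ 1) * + K mod n
  ∣⇒mod-∸-pred {m} {K} {n} 1≤n K≤m n∣m = mod-trans (mod-∸ K≤m (∣⇒mod0 n∣m) (mod-reflexive refl)) wrap
    where
    wrap : + 0 - + K ≡ + (n ∸ 1) * + K mod n
    wrap = mod-sym (mod-respʳ (ℤ.+-identityˡ (+ 0 - + K))
                    (mod-respˡ (trans (fold (+ K) (+ n)) (cong (_* + K) (sym (pos-∸ 1≤n))))
                      (mod-+ (multiple-mod0 (+ K) n) (mod-reflexive {b = + 0 - + K} refl))))
      where
      fold : ∀ k n → k * n + (+ 0 - k) ≡ (n - + 1) * k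
      fold = solve-∀

  mod-walk : ∀ {n K w a b} i → + 1 ≡ w * + K mod n → + b ≡ a * + K mod n → i ≤ b →
             + (b ∸ i) ≡ (a - + i * w) * + K mod n
  mod-walk {n} {K} {w} {a} {b} i 1≡wK b≡aK i≤b =
    mod-respʳ (regroup a (+ i) w (+ K))
      (mod-∸ i≤b b≡aK (mod-respˡ (ℤ.*-identityʳ (+ i)) (mod-* (+ i) 1≡wK)))
    where
    regroup : ∀ a i w k → a * k - i * (w * k) ≡ (a - i * w) * k
    regroup = solve-∀

  mod-unit : ∀ {n K w} j .{{_ : NonZero n}} → + 1 ≡ w * + K mod n → + j ≡ + ((+ j * w) %ℕ n) * + K mod n
  mod-unit {n} {K} {w} j 1≡wK =
    mod-trans (mod-respˡ (ℤ.*-identityʳ (+ j)) (mod-respʳ (sym (ℤ.*-assoc (+ j) w (+ K))) (mod-* (+ j) 1≡wK)))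
              (mod-*ʳ (+ K) (%ℕ-mod (+ j * w) n))

  coprime-*ʳ : ∀ {n a b} → Coprime n a → Coprime n b → Coprime n (a ℕ.* b)
  coprime-*ʳ {n} {a} {b} n⊥a n⊥b (i∣n , i∣ab) =
    n⊥b (i∣n , coprime-divisor (λ (j∣i , j∣a) → n⊥a (ℕ.∣-trans j∣i i∣n , j∣a)) i∣ab)

  coprime-∣-* : ∀ {a b m} → Coprime a b → a ℕ.∣ m → b ℕ.∣ m → a ℕ.* b ℕ.∣ m
  coprime-∣-* {a} {b} a⊥b (ℕ.divides c refl) b∣ca with coprime-divisor (Coprime.sym a⊥b) (subst (b ℕ.∣_) (ℕ.*-comm c a) b∣ca)
  ... | ℕ.divides d refl = ℕ.divides d (trans (ℕ.*-assoc d b a) (cong (d ℕ.*_) (ℕ.*-comm b a)))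

  coprime-∣-*⇒≡0 : ∀ {n K X} → Coprime n K → n ℕ.∣ X ℕ.* K → X < n → X ≡ 0
  coprime-∣-*⇒≡0 {n} {K} {zero}  _   _    _   = refl
  coprime-∣-*⇒≡0 {n} {K} {suc X} n⊥K n∣XK X<n =
    contradiction (ℕ.∣⇒≤ (coprime-divisor n⊥K (subst (n ℕ.∣_) (ℕ.*-comm (suc X) K) n∣XK))) (ℕ.<⇒≱ X<n)

  ≡-*-coprime⇒∤ : ∀ {n K X m} → Coprime n K → 1 ≤ X → X < n → + m ≡ + X * + K mod n → ¬ n ℕ.∣ m
  ≡-*-coprime⇒∤ {n} {K} {X} {m} n⊥K 1≤X X<n m≡XK n∣m =
    contradiction (coprime-∣-*⇒≡0 n⊥K (mod0⇒∣ XK≡0) X<n) (ℕ.n>0⇒n≢0 1≤X)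
    where
    XK≡0 : + (X ℕ.* K) ≡ + 0 mod n
    XK≡0 = subst (_≡ + 0 mod n) (sym (ℤ.pos-* X K)) (mod-trans (mod-sym m≡XK) (∣⇒mod0 n∣m))

open Congruences

module Arithmetic where

  open import Data.Nat using (_+_; _*_)

  ∣m∣n⇒∣m∸n : ∀ {d m n} → n ≤ m → d ℕ.∣ m → d ℕ.∣ n → d ℕ.∣ m ∸ n
  ∣m∣n⇒∣m∸n {d} {m} {n} n≤m d∣m d∣n = ℕ.∣m+n∣m⇒∣n (subst (d ℕ.∣_) (sym (ℕ.m+[n∸m]≡n n≤m)) d∣m) d∣n

  <+⇒∸< : ∀ {m n o} → n ≤ m → m < n + o → m ∸ n < o
  <+⇒∸< {m} {n} {o} n≤m m<n+o = subst (m ∸ n <_) (ℕ.m+n∸m≡n n o) (ℕ.∸-monoˡ-< m<n+o n≤m)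

  +≤⇒≤∸ : ∀ {m n o} → n + o ≤ m → o ≤ m ∸ n
  +≤⇒≤∸ {m} {n} {o} n+o≤m = ℕ.m+n≤o⇒m≤o∸n o (subst (_≤ m) (ℕ.+-comm n o) n+o≤m)

  private
    ≤-by : ∀ {a b} d → b ≡ a + d → a ≤ b
    ≤-by {a} d refl = ℕ.m≤m+n a d

    slack : ∀ {m n} → m ≤ n → Σ ℕ λ d → n ≡ m + d
    slack {m} {n} m≤n = n ∸ m , sym (ℕ.m+[n∸m]≡n m≤n)

  t·rp<u·qr : ∀ t p q r u → t * p < q → 1 ≤ u → 1 ≤ r → t * (r * p) + 1 ≤ u * (q * r)
  t·rp<u·qr t p q r u t·p<q 1≤u 1≤r = begin
    t * (r * p) + 1 ≤⟨ ℕ.+-monoʳ-≤ (t * (r * p)) 1≤r ⟩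
    t * (r * p) + r ≡⟨ regroup t p r ⟩
    (t * p + 1) * r ≤⟨ ℕ.*-monoˡ-≤ r (subst (_≤ q) (ℕ.+-comm 1 (t * p)) t·p<q) ⟩
    q * r           ≤⟨ ℕ.m≤n*m (q * r) u {{ℕ.>-nonZero 1≤u}} ⟩
    u * (q * r)     ∎
    where
    open ℕ.≤-Reasoning
    regroup : ∀ t p r → t * (r * p) + r ≡ (t * p + 1) * r
    regroup = NatSolver.solve-∀

  pq+q≤qr : ∀ p q r → p < r → p * q + q ≤ q * r
  pq+q≤qr p q r p<r = begin
    p * q + q   ≡⟨ regroup p q ⟩
    q * suc p   ≤⟨ ℕ.*-monoʳ-≤ q p<r ⟩
    q * r       ∎
    where
    open ℕ.≤-Reasoning
    regroup : ∀ p q → p * q + q ≡ q * suc p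
    regroup = NatSolver.solve-∀

  p+r≤pr : ∀ p r → 2 ≤ p → 2 ≤ r → p + r ≤ p * r
  p+r≤pr p r 2≤p 2≤r with slack 2≤p | slack 2≤r
  ... | a , refl | b , refl = ≤-by (a + b + a * b) (expand a b)
    where
    expand : ∀ a b → (2 + a) * (2 + b) ≡ 2 + a + (2 + b) + (a + b + a * b)
    expand = NatSolver.solve-∀

  pred-p·qr+r≤[q∸w]·rp : ∀ p q r w → 1 ≤ p → p * w < q → (p ∸ 1) * (q * r) + r ≤ (q ∸ w) * (r * p)
  pred-p·qr+r≤[q∸w]·rp (suc p′) q r w _ p·w<q = ℕ.+-cancelʳ-≤ (w * (r * p)) _ _ $ begin
    p′ * (q * r) + r + w * (r * p)      ≡⟨ regroup p′ q r w ⟩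
    p′ * (q * r) + (p * w + 1) * r      ≤⟨ ℕ.+-monoʳ-≤ (p′ * (q * r)) (ℕ.*-monoˡ-≤ r (subst (_≤ q) (ℕ.+-comm 1 (p * w)) p·w<q)) ⟩
    p′ * (q * r) + q * r                ≡⟨ fold p′ q r ⟩
    q * (r * p)                         ≡⟨ cong (_* (r * p)) (sym (ℕ.m∸n+n≡m w≤q)) ⟩
    (q ∸ w + w) * (r * p)               ≡⟨ ℕ.*-distribʳ-+ (r * p) (q ∸ w) w ⟩
    (q ∸ w) * (r * p) + w * (r * p)     ∎
    where
    open ℕ.≤-Reasoning
    p = suc p′
    w≤q : w ≤ q
    w≤q = ℕ.≤-trans (ℕ.m≤m+n w (p′ * w)) (ℕ.<⇒≤ p·w<q)
    regroup : ∀ p′ q r w → p′ * (q * r) + r + w * (r * suc p′) ≡ p′ * (q * r) + (suc p′ * w + 1) * r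
    regroup = NatSolver.solve-∀
    fold : ∀ p′ q r → p′ * (q * r) + q * r ≡ q * (r * suc p′)
    fold = NatSolver.solve-∀

  2pq+rp≤2qr : ∀ p q r → p * p < q → p < r → 2 * (p * q) + r * p ≤ 2 * (q * r)
  2pq+rp≤2qr p q r p²<q p<r with slack p<r
  ... | d , refl = begin
    2 * (p * q) + (suc p + d) * p       ≡⟨ expand₁ p q d ⟩
    2 * (p * q) + (p * p + p) + d * p   ≤⟨ ℕ.+-mono-≤ (ℕ.+-monoʳ-≤ (2 * (p * q)) (ℕ.+-mono-≤ (ℕ.<⇒≤ p²<q) p≤q))
                                                      (ℕ.*-monoʳ-≤ d (ℕ.≤-trans p≤q (ℕ.m≤m+n q (q + 0)))) ⟩
    2 * (p * q) + (q + q) + d * (2 * q) ≡⟨ expand₂ p q d ⟩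
    2 * (q * (suc p + d))               ∎
    where
    open ℕ.≤-Reasoning
    p≤q : p ≤ q
    p≤q = ℕ.<⇒≤ (ℕ.≤-<-trans (n≤n*n p) p²<q)
      where
      n≤n*n : ∀ n → n ≤ n * n
      n≤n*n zero    = z≤n
      n≤n*n (suc n) = ℕ.m≤m*n (suc n) (suc n)
    expand₁ : ∀ p q d → 2 * (p * q) + (suc p + d) * p ≡ 2 * (p * q) + (p * p + p) + d * p
    expand₁ = NatSolver.solve-∀
    expand₂ : ∀ p q d → 2 * (p * q) + (q + q) + d * (2 * q) ≡ 2 * (q * (suc p + d))
    expand₂ = NatSolver.solve-∀

  window-margin : ∀ P U Z w Q → P * w + P ≤ Q → (U + 2) * (Q + 1) ≤ P * (Z + w) + 1 → (U + 1) * (Q + 1) + P ≤ P * Z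
  window-margin P U Z w Q Pw+P≤Q hyp = ℕ.+-cancelʳ-≤ (P * w + 1) _ _ $ begin
    (U + 1) * (Q + 1) + P + (P * w + 1) ≡⟨ regroup₁ U Q P w ⟩
    (U + 1) * (Q + 1) + (P * w + P) + 1 ≤⟨ ℕ.+-monoˡ-≤ 1 (ℕ.+-monoʳ-≤ ((U + 1) * (Q + 1)) Pw+P≤Q) ⟩
    (U + 1) * (Q + 1) + Q + 1           ≡⟨ regroup₂ U Q ⟩
    (U + 2) * (Q + 1)                   ≤⟨ hyp ⟩
    P * (Z + w) + 1                     ≡⟨ regroup₃ P Z w ⟩
    P * Z + (P * w + 1)                 ∎
    where
    open ℕ.≤-Reasoning
    regroup₁ : ∀ U Q P w → (U + 1) * (Q + 1) + P + (P * w + 1) ≡ (U + 1) * (Q + 1) + (P * w + P) + 1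
    regroup₁ = NatSolver.solve-∀
    regroup₂ : ∀ U Q → (U + 1) * (Q + 1) + Q + 1 ≡ (U + 2) * (Q + 1)
    regroup₂ = NatSolver.solve-∀
    regroup₃ : ∀ P Z w → P * (Z + w) + 1 ≡ P * Z + (P * w + 1)
    regroup₃ = NatSolver.solve-∀

  multiple-above : ∀ {q N} a → q ℕ.∣ N → a * q < N → suc a * q ≤ N
  multiple-above {q} a (ℕ.divides c refl) a·q<c·q = ℕ.*-monoˡ-≤ q (ℕ.*-cancelʳ-< q a c a·q<c·q)

open Arithmetic

module Coefficients (p q r : ℕ) (1≤p : 1 ≤ p) (1≤q : 1 ≤ q) (1≤r : 1 ≤ r)
                    (p⊥q : Coprime p q) (q⊥r : Coprime q r) (r⊥p : Coprime r p) where

  open import Data.Integer using (_+_; _-_; _*_)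

  qr rp : ℕ
  qr = q ℕ.* r
  rp = r ℕ.* p

  1≤pq : 1 ≤ p ℕ.* q
  1≤pq = ℕ.*-mono-≤ 1≤p 1≤q
  1≤qr : 1 ≤ qr
  1≤qr = ℕ.*-mono-≤ 1≤q 1≤r
  1≤rp : 1 ≤ rp
  1≤rp = ℕ.*-mono-≤ 1≤r 1≤p

  p⊥qr : Coprime p qr
  p⊥qr = coprime-*ʳ p⊥q (Coprime.sym r⊥p)
  q⊥rp : Coprime q rp
  q⊥rp = coprime-*ʳ q⊥r (Coprime.sym p⊥q)

  F₁ F₂ : Series
  F₁ = divOneMinus (p ℕ.* q) one
  F₂ = divOneMinus qr F₁

  F₂-∤ : ∀ m → ¬ q ℕ.∣ m → F₂ m ≡ + 0
  F₂-∤ = divOneMinus-vanishes 1≤qr (ℕ.m∣m*n r)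
    λ m q∤m → divOneMinus-one-∤ 1≤pq m λ pq∣m → q∤m (ℕ.m*n∣⇒n∣ p q pq∣m)

  F₁-∤ : ∀ {X m} → 1 ≤ X → X < p → + m ≡ + X * + qr mod p → F₁ m ≡ + 0
  F₁-∤ {X} {m} 1≤X X<p m≡ = divOneMinus-one-∤ 1≤pq m λ pq∣m →
    ≡-*-coprime⇒∤ p⊥qr 1≤X X<p m≡ (ℕ.m*n∣⇒m∣ p q pq∣m)

  F₂-below : ∀ X m → X < p → + m ≡ + X * + qr mod p → m < X ℕ.* qr → F₂ m ≡ + 0
  F₂-below (suc X) m X<p m≡ m<Xqr = begin
    F₂ m                 ≡⟨ divOneMinus-rec F₁ m 1≤qr ⟩
    F₁ m + shift qr F₂ m ≡⟨ cong₂ _+_ (F₁-∤ (s≤s z≤n) X<p m≡) (shift-vanishes F₂ λ qr≤m →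
                              F₂-below X (m ∸ qr) (ℕ.<-trans (ℕ.n<1+n X) X<p) (mod-∸-suc X qr≤m m≡) (<+⇒∸< qr≤m m<Xqr)) ⟩
    + 0                  ∎
    where open ≡-Reasoning

  F₂-above : ∀ X m → X < p → m < p ℕ.* qr → + m ≡ + X * + qr mod p → q ℕ.∣ m → X ℕ.* qr ≤ m → F₂ m ≡ + 1
  F₂-above zero m _ m<pqr m≡0 q∣m _ = begin
    F₂ m                 ≡⟨ divOneMinus-rec F₁ m 1≤qr ⟩
    F₁ m + shift qr F₂ m ≡⟨ cong₂ _+_ (divOneMinus-one-∣ 1≤pq m (coprime-∣-* p⊥q p∣m q∣m)) (shift-vanishes F₂ λ qr≤m →
                              F₂-below (p ∸ 1) (m ∸ qr) (ℕ.∸-monoʳ-< (s≤s z≤n) 1≤p) (∣⇒mod-∸-pred 1≤p qr≤m p∣m) (bound qr≤m)) ⟩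
    + 1                  ∎
    where
    open ≡-Reasoning
    p∣m = mod0⇒∣ m≡0
    bound : qr ≤ m → m ∸ qr < (p ∸ 1) ℕ.* qr
    bound qr≤m = subst (m ∸ qr <_) (trans (cong (p ℕ.* qr ∸_) (sym (ℕ.*-identityˡ qr))) (sym (ℕ.*-distribʳ-∸ qr p 1)))
                       (ℕ.∸-monoˡ-< m<pqr qr≤m)
  F₂-above (suc X) m X<p m<pqr m≡ q∣m Xqr≤m = begin
    F₂ m                 ≡⟨ divOneMinus-rec F₁ m 1≤qr ⟩
    F₁ m + shift qr F₂ m ≡⟨ cong₂ _+_ (F₁-∤ (s≤s z≤n) X<p m≡) (shift-≤ F₂ qr≤m) ⟩
    + 0 + F₂ (m ∸ qr)    ≡⟨ ℤ.+-identityˡ _ ⟩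
    F₂ (m ∸ qr)          ≡⟨ F₂-above X (m ∸ qr) (ℕ.<-trans (ℕ.n<1+n X) X<p) (ℕ.≤-<-trans (ℕ.m∸n≤m m qr) m<pqr)
                              (mod-∸-suc X qr≤m m≡) (∣m∣n⇒∣m∸n qr≤m q∣m (ℕ.m∣m*n r)) (+≤⇒≤∸ Xqr≤m) ⟩
    + 1                  ∎
    where
    open ≡-Reasoning
    qr≤m : qr ≤ m
    qr≤m = ℕ.m+n≤o⇒m≤o qr Xqr≤m

  FChar : ℕ → Set
  FChar m = ∀ X Y → X < p → Y < q → m < p ℕ.* qr → + m ≡ + X * + qr mod p → + m ≡ + Y * + rp mod q →
            (X ℕ.* qr ℕ.+ Y ℕ.* rp ≤ m → F p q r m ≡ + 1) × (m < X ℕ.* qr ℕ.+ Y ℕ.* rp → F p q r m ≡ + 0)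

  private
    p∣rp : p ℕ.∣ rp
    p∣rp = ℕ.n∣m*n r

    F-char-Y≡0 : ∀ m → (∀ {m′} → m′ < m → FChar m′) → ∀ X → X < p → 0 < q → m < p ℕ.* qr →
                 + m ≡ + X * + qr mod p → + m ≡ + 0 * + rp mod q →
                 (X ℕ.* qr ℕ.+ 0 ≤ m → F p q r m ≡ + 1) × (m < X ℕ.* qr ℕ.+ 0 → F p q r m ≡ + 0)
    F-char-Y≡0 m ih X X<p _ m<pqr m≡X m≡0 =
      (λ Xqr≤m → trans (divOneMinus-rec F₂ m 1≤rp)
        (cong₂ _+_ (F₂-above X m X<p m<pqr m≡X q∣m (subst (_≤ m) (ℕ.+-identityʳ _) Xqr≤m)) tail)) ,
      (λ m<Xqr → trans (divOneMinus-rec F₂ m 1≤rp)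
        (cong₂ _+_ (F₂-below X m X<p m≡X (subst (m <_) (ℕ.+-identityʳ _) m<Xqr)) tail))
      where
      q∣m = mod0⇒∣ m≡0
      pqr∸rp≡ : p ℕ.* qr ∸ rp ≡ (q ∸ 1) ℕ.* rp
      pqr∸rp≡ = trans (cong₂ _∸_ (reassoc p q r) (sym (ℕ.*-identityˡ rp))) (sym (ℕ.*-distribʳ-∸ rp q 1))
        where
        reassoc : ∀ p q r → p ℕ.* (q ℕ.* r) ≡ q ℕ.* (r ℕ.* p)
        reassoc = NatSolver.solve-∀
      tail : shift rp (F p q r) m ≡ + 0
      tail = shift-vanishes _ λ rp≤m → proj₂
        (ih (ℕ.∸-monoʳ-< 1≤rp rp≤m) X (q ∸ 1) X<p (ℕ.∸-monoʳ-< (s≤s z≤n) 1≤q) (ℕ.≤-<-trans (ℕ.m∸n≤m m rp) m<pqr)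
            (mod-∸-∣ rp≤m p∣rp m≡X) (∣⇒mod-∸-pred 1≤q rp≤m q∣m))
        (ℕ.<-≤-trans (subst (m ∸ rp <_) pqr∸rp≡ (ℕ.∸-monoˡ-< m<pqr rp≤m)) (ℕ.m≤n+m _ (X ℕ.* qr)))

    F-char-Y≡suc : ∀ m → (∀ {m′} → m′ < m → FChar m′) → ∀ X Y → X < p → suc Y < q → m < p ℕ.* qr →
                   + m ≡ + X * + qr mod p → + m ≡ + suc Y * + rp mod q →
                   (X ℕ.* qr ℕ.+ suc Y ℕ.* rp ≤ m → F p q r m ≡ + 1) × (m < X ℕ.* qr ℕ.+ suc Y ℕ.* rp → F p q r m ≡ + 0)
    F-char-Y≡suc m ih X Y X<p Y<q m<pqr m≡X m≡Y = above , below
      where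
      open ≡-Reasoning
      F₂≡0 : F₂ m ≡ + 0
      F₂≡0 = F₂-∤ m (≡-*-coprime⇒∤ q⊥rp (s≤s z≤n) Y<q m≡Y)
      regroup : X ℕ.* qr ℕ.+ suc Y ℕ.* rp ≡ rp ℕ.+ (X ℕ.* qr ℕ.+ Y ℕ.* rp)
      regroup = swap (X ℕ.* qr) rp (Y ℕ.* rp)
        where
        swap : ∀ a b c → a ℕ.+ (b ℕ.+ c) ≡ b ℕ.+ (a ℕ.+ c)
        swap = NatSolver.solve-∀
      ih′ : rp ≤ m → _
      ih′ rp≤m = ih (ℕ.∸-monoʳ-< 1≤rp rp≤m) X Y X<p (ℕ.<-trans (ℕ.n<1+n Y) Y<q) (ℕ.≤-<-trans (ℕ.m∸n≤m m rp) m<pqr)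
                    (mod-∸-∣ rp≤m p∣rp m≡X) (mod-∸-suc Y rp≤m m≡Y)
      above : X ℕ.* qr ℕ.+ suc Y ℕ.* rp ≤ m → F p q r m ≡ + 1
      above ≤m = begin
        F p q r m                    ≡⟨ divOneMinus-rec F₂ m 1≤rp ⟩
        F₂ m + shift rp (F p q r) m  ≡⟨ cong₂ _+_ F₂≡0 (shift-≤ _ rp≤m) ⟩
        + 0 + F p q r (m ∸ rp)       ≡⟨ ℤ.+-identityˡ _ ⟩
        F p q r (m ∸ rp)             ≡⟨ proj₁ (ih′ rp≤m) (+≤⇒≤∸ {n = rp} rp+≤m) ⟩
        + 1                          ∎
        where
        rp+≤m = subst (_≤ m) regroup ≤m
        rp≤m = ℕ.m+n≤o⇒m≤o rp rp+≤m
      below : m < X ℕ.* qr ℕ.+ suc Y ℕ.* rp → F p q r m ≡ + 0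
      below m< = trans (divOneMinus-rec F₂ m 1≤rp) (cong₂ _+_ F₂≡0
        (shift-vanishes _ λ rp≤m → proj₂ (ih′ rp≤m) (<+⇒∸< {n = rp} rp≤m (subst (m <_) regroup m<))))

  F-char : ∀ m → FChar m
  F-char = <-rec FChar λ where
    m ih X zero    → F-char-Y≡0 m ih X
    m ih X (suc Y) → F-char-Y≡suc m ih X Y

module Windows (p q r : ℕ) (1≤p : 1 ≤ p) (1≤q : 1 ≤ q) (1≤r : 1 ≤ r)
               (p⊥q : Coprime p q) (q⊥r : Coprime q r) (r⊥p : Coprime r p)
               (u v : ℕ) (v<q : v < q)
               (1≡uqr : + 1 ≡ + u ℤ.* + (q ℕ.* r) mod p) (1≡vrp : + 1 ≡ + v ℤ.* + (r ℕ.* p) mod q)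
               (tp²<q : (q ∸ v) ℕ.* (p ℕ.* p) < q) where

  open import Data.Integer using (_+_; _-_; _*_)

  open Coefficients p q r 1≤p 1≤q 1≤r p⊥q q⊥r r⊥p public

  instance
    _ = ℕ.>-nonZero 1≤p

  t : ℕ
  t = q ∸ v

  v+t≡q : + v + + t ≡ + q
  v+t≡q = cong +_ (ℕ.m+[n∸m]≡n (ℕ.<⇒≤ v<q))

  1≤t : 1 ≤ t
  1≤t = ℕ.m<n⇒0<n∸m v<q

  pt<q : p ℕ.* t < q
  pt<q = ℕ.≤-<-trans (ℕ.≤-trans (ℕ.≤-reflexive (ℕ.*-comm p t)) (ℕ.*-monoʳ-≤ t (ℕ.m≤m*n p p))) tp²<q

  -- Since v ≡ -t (mod q), walking down by i adds i·t to the residue modulo q.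
  walk-v : ∀ {c} Z i → c ≡ + Z mod q → c - + i * + v ≡ + (Z ℕ.+ i ℕ.* t) mod q
  walk-v {c} Z i (≡mod c≡Z) = ≡mod $ begin
    _                               ∣⟨ ∣m∣n⇒∣m-n c≡Z (∣n⇒∣m*n (+ i) (∣-refl {+ q})) ⟩
    (c - + Z) - + i * + q           ≡⟨ cong (λ s → (c - + Z) - + i * s) (sym v+t≡q) ⟩
    (c - + Z) - + i * (+ v + + t)   ≡⟨ regroup c (+ Z) (+ i) (+ v) (+ t) ⟩
    (c - + i * + v) - (+ Z + + i * + t) ≡⟨ cong (λ s → (c - + i * + v) - (+ Z + s)) (sym (ℤ.pos-* i t)) ⟩
    (c - + i * + v) - + (Z ℕ.+ i ℕ.* t) ∎
    where
    open ∣-Reasoning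
    regroup : ∀ c z i v t → (c - z) - i * (v + t) ≡ (c - i * v) - (z + i * t)
    regroup = solve-∀

  walk-p : ∀ a {b} i → + b ≡ a * + qr mod p → i ≤ b → + (b ∸ i) ≡ (a - + i * + u) * + qr mod p
  walk-p a i = mod-walk {K = qr} {w = + u} {a = a} i 1≡uqr

  walk-q : ∀ c {b} i → + b ≡ c * + rp mod q → i ≤ b → + (b ∸ i) ≡ (c - + i * + v) * + rp mod q
  walk-q c i = mod-walk {K = rp} {w = + v} {a = c} i 1≡vrp

  F≡0-Y : ∀ {b} a c Z i → + b ≡ a * + qr mod p → + b ≡ c * + rp mod q → c ≡ + Z mod q →
              Z ℕ.+ i ℕ.* t < q → b < Z ℕ.* rp → b < p ℕ.* qr → i ≤ b → F p q r (b ∸ i) ≡ + 0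
  F≡0-Y {b} a c Z i b≡aqr b≡crp c≡Z Y<q b<Zrp b<pqr i≤b =
    proj₂ (F-char (b ∸ i) X Y (n%ℕd<d (a - + i * + u) p) Y<q (ℕ.≤-<-trans (ℕ.m∸n≤m b i) b<pqr)
                  (mod-trans (walk-p a i b≡aqr i≤b) (mod-*ʳ (+ qr) (%ℕ-mod (a - + i * + u) p)))
                  (mod-trans (walk-q c i b≡crp i≤b) (mod-*ʳ (+ rp) (walk-v Z i c≡Z))))
          (ℕ.≤-<-trans (ℕ.m∸n≤m b i) (ℕ.<-≤-trans b<Zrp (ℕ.≤-trans (ℕ.*-monoˡ-≤ rp (ℕ.m≤m+n Z _)) (ℕ.m≤n+m _ _))))
    where
    X = (a - + i * + u) %ℕ p
    Y = Z ℕ.+ i ℕ.* t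

  W≡0-Y : ∀ {b} a c Z → + b ≡ a * + qr mod p → + b ≡ c * + rp mod q → c ≡ + Z mod q →
              Z ℕ.+ p ℕ.* t ≤ q → b < Z ℕ.* rp → b < p ℕ.* qr → W p q r b ≡ + 0
  W≡0-Y a c Z b≡aqr b≡crp c≡Z Z+pt≤q b<Zrp b<pqr = Σ<-zero p λ i i<p → shift-vanishes _
    (F≡0-Y a c Z i b≡aqr b≡crp c≡Z (ℕ.<-≤-trans (ℕ.+-monoʳ-< Z (ℕ.*-monoˡ-< t {{ℕ.>-nonZero 1≤t}} i<p)) Z+pt≤q) b<Zrp b<pqr)

  module Window (m : ℕ) (1≤m : 1 ≤ m) (m≤p : m ≤ p) where

    p∸m U Zlow : ℕ
    p∸m  = p ∸ m
    U    = (m ∸ 1) ℕ.* u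
    Zlow = q ∸ p∸m ℕ.* t

    p∸m+m≡p : p∸m ℕ.+ m ≡ p
    p∸m+m≡p = ℕ.m∸n+n≡m m≤p

    p∸m·t<q : p∸m ℕ.* t < q
    p∸m·t<q = ℕ.≤-<-trans (ℕ.*-monoˡ-≤ t (ℕ.m∸n≤m p m)) pt<q

    Zlow+p∸m·t≡q : Zlow ℕ.+ p∸m ℕ.* t ≡ q
    Zlow+p∸m·t≡q = ℕ.m∸n+n≡m (ℕ.<⇒≤ p∸m·t<q)

    F-low : ∀ {b} a c i → + b ≡ a * + qr mod p → + b ≡ c * + rp mod q → c ≡ + Zlow mod q →
            i < p∸m → b < Zlow ℕ.* rp → b < p ℕ.* qr → i ≤ b → F p q r (b ∸ i) ≡ + 0
    F-low a c i b≡aqr b≡crp c≡Z i<p∸m = F≡0-Y a c Zlow i b≡aqr b≡crp c≡Z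
      (subst (Zlow ℕ.+ i ℕ.* t <_) Zlow+p∸m·t≡q (ℕ.+-monoʳ-< Zlow (ℕ.*-monoˡ-< t {{ℕ.>-nonZero 1≤t}} i<p∸m)))

    F-high-residues : ∀ {b} a c x₀ d → d < m → p∸m ℕ.+ d ≤ b →
      + b ≡ a * + qr mod p → + b ≡ c * + rp mod q → a ≡ + x₀ - + u mod p → c ≡ + Zlow mod q →
      (+ (b ∸ (p∸m ℕ.+ d)) ≡ + (x₀ ℕ.+ ((m ∸ 1) ∸ d) ℕ.* u) * + qr mod p) ×
      (+ (b ∸ (p∸m ℕ.+ d)) ≡ + (d ℕ.* t) * + rp mod q)
    F-high-residues a c x₀ d d<m i≤b b≡aqr b≡crp a≡ c≡Z =
      mod-trans (walk-p a i b≡aqr i≤b) (mod-*ʳ (+ qr) resP) ,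
      mod-trans (walk-q c i b≡crp i≤b) (mod-*ʳ (+ rp) resQ)
      where
      i = p∸m ℕ.+ d
      e = (m ∸ 1) ∸ d
      i+1+e≡p : i ℕ.+ 1 ℕ.+ e ≡ p
      i+1+e≡p = begin
        p∸m ℕ.+ d ℕ.+ 1 ℕ.+ e     ≡⟨ regroup p∸m d e ⟩
        p∸m ℕ.+ ((e ℕ.+ d) ℕ.+ 1) ≡⟨ cong (λ x → p∸m ℕ.+ (x ℕ.+ 1)) (ℕ.m∸n+n≡m d≤m∸1) ⟩
        p∸m ℕ.+ ((m ∸ 1) ℕ.+ 1)   ≡⟨ cong (p∸m ℕ.+_) (ℕ.m∸n+n≡m 1≤m) ⟩
        p∸m ℕ.+ m                 ≡⟨ p∸m+m≡p ⟩
        p                         ∎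
        where
        open ≡-Reasoning
        d≤m∸1 : d ≤ m ∸ 1
        d≤m∸1 = ℕ.m+n≤o⇒m≤o∸n d (subst (_≤ m) (ℕ.+-comm 1 d) d<m)
        regroup : ∀ a d e → a ℕ.+ d ℕ.+ 1 ℕ.+ e ≡ a ℕ.+ ((e ℕ.+ d) ℕ.+ 1)
        regroup = NatSolver.solve-∀
      resP : a - + i * + u ≡ + (x₀ ℕ.+ e ℕ.* u) mod p
      resP = mod-trans (mod-sub a≡ (mod-reflexive {b = + i * + u} refl)) (mod-respˡ eqP (-multiple-mod (+ (x₀ ℕ.+ e ℕ.* u)) (+ u) p))
        where
        regroup : ∀ x e u i → (x + e * u) - u * ((i + + 1) + e) ≡ (x - u) - i * u
        regroup = solve-∀
        eqP : + (x₀ ℕ.+ e ℕ.* u) - + u * + p ≡ (+ x₀ - + u) - + i * + u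
        eqP = trans (cong₂ (λ y z → (+ x₀ + y) - + u * z) (ℤ.pos-* e u) (cong +_ (sym i+1+e≡p)))
                    (regroup (+ x₀) (+ e) (+ u) (+ i))
      resQ : c - + i * + v ≡ + (d ℕ.* t) mod q
      resQ = mod-trans (walk-v Zlow i c≡Z) (mod-respˡ (cong +_ (sym q+dt)) (n+-mod q (d ℕ.* t)))
        where
        q+dt : Zlow ℕ.+ i ℕ.* t ≡ q ℕ.+ d ℕ.* t
        q+dt = trans (cong (Zlow ℕ.+_) (ℕ.*-distribʳ-+ t p∸m d)) (trans (sym (ℕ.+-assoc Zlow _ _)) (cong (ℕ._+ d ℕ.* t) Zlow+p∸m·t≡q))

    high-index : ∀ {P : ℕ → Set} → (∀ d → d < m → P (p∸m ℕ.+ d)) → ∀ i → i < p → p∸m ≤ i → P i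
    high-index {P} P-high i i<p p∸m≤i = subst P (ℕ.m+[n∸m]≡n p∸m≤i)
      (P-high (i ∸ p∸m) (<+⇒∸< p∸m≤i (subst (i <_) (sym p∸m+m≡p) i<p)))

    F-high : ∀ {b} a c x₀ d → d < m → p∸m ℕ.+ d ≤ b → x₀ ℕ.+ U < p → b < p ℕ.* qr →
      + b ≡ a * + qr mod p → + b ≡ c * + rp mod q → a ≡ + x₀ - + u mod p → c ≡ + Zlow mod q →
      let X = x₀ ℕ.+ ((m ∸ 1) ∸ d) ℕ.* u
          Y = d ℕ.* t
      in (X ℕ.* qr ℕ.+ Y ℕ.* rp ≤ b ∸ (p∸m ℕ.+ d) → F p q r (b ∸ (p∸m ℕ.+ d)) ≡ + 1) ×
         (b ∸ (p∸m ℕ.+ d) < X ℕ.* qr ℕ.+ Y ℕ.* rp → F p q r (b ∸ (p∸m ℕ.+ d)) ≡ + 0)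
    F-high {b} a c x₀ d d<m i≤b x₀+U<p b<pqr b≡aqr b≡crp a≡ c≡Z =
      F-char (b ∸ (p∸m ℕ.+ d)) _ _ X<p Y<q (ℕ.≤-<-trans (ℕ.m∸n≤m b (p∸m ℕ.+ d)) b<pqr)
             (proj₁ residues) (proj₂ residues)
      where
      residues = F-high-residues a c x₀ d d<m i≤b b≡aqr b≡crp a≡ c≡Z
      X<p : x₀ ℕ.+ ((m ∸ 1) ∸ d) ℕ.* u < p
      X<p = ℕ.≤-<-trans (ℕ.+-monoʳ-≤ x₀ (ℕ.*-monoˡ-≤ u (ℕ.m∸n≤m (m ∸ 1) d))) x₀+U<p
      Y<q : d ℕ.* t < q
      Y<q = ℕ.≤-<-trans (ℕ.*-monoˡ-≤ t (ℕ.≤-trans (ℕ.<⇒≤ d<m) m≤p)) pt<q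

    W≡m : ∀ {b} a c → + b ≡ a * + qr mod p → + b ≡ c * + rp mod q → a ≡ + 0 - + u mod p → c ≡ + Zlow mod q →
          U ℕ.* qr ℕ.+ p∸m ≤ b → t ℕ.* rp ℕ.+ 1 ≤ u ℕ.* qr → U < p → b < Zlow ℕ.* rp → b < p ℕ.* qr →
          W p q r b ≡ + m
    W≡m {b} a c b≡aqr b≡crp a≡ c≡Z U·qr+p∸m≤b t·rp<u·qr U<p b<Zrp b<pqr =
      trans (Σ<-indicator p∸m p _ low (high-index high))
            (cong +_ (ℕ.m∸[m∸n]≡n m≤p))
      where
      low : ∀ i → i < p → i < p∸m → shift i (F p q r) b ≡ + 0
      low i _ i<p∸m = shift-vanishes _ (F-low a c i b≡aqr b≡crp c≡Z i<p∸m b<Zrp b<pqr)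
      high : ∀ d → d < m → shift (p∸m ℕ.+ d) (F p q r) b ≡ + 1
      high d d<m = trans (shift-≤ _ i≤b)
        (proj₁ (F-high a c 0 d d<m i≤b U<p b<pqr b≡aqr b≡crp a≡ c≡Z) (ℕ.m+n≤o⇒m≤o∸n _ key))
        where
        e = (m ∸ 1) ∸ d
        e+d≡m∸1 : e ℕ.+ d ≡ m ∸ 1
        e+d≡m∸1 = ℕ.m∸n+n≡m (ℕ.m+n≤o⇒m≤o∸n d (subst (_≤ m) (ℕ.+-comm 1 d) d<m))
        key : e ℕ.* u ℕ.* qr ℕ.+ d ℕ.* t ℕ.* rp ℕ.+ (p∸m ℕ.+ d) ≤ b
        key = begin
          e ℕ.* u ℕ.* qr ℕ.+ d ℕ.* t ℕ.* rp ℕ.+ (p∸m ℕ.+ d)  ≡⟨ regroup₁ e u qr d t rp p∸m ⟩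
          e ℕ.* u ℕ.* qr ℕ.+ d ℕ.* (t ℕ.* rp ℕ.+ 1) ℕ.+ p∸m ≤⟨ ℕ.+-monoˡ-≤ p∸m (ℕ.+-monoʳ-≤ (e ℕ.* u ℕ.* qr) (ℕ.*-monoʳ-≤ d t·rp<u·qr)) ⟩
          e ℕ.* u ℕ.* qr ℕ.+ d ℕ.* (u ℕ.* qr) ℕ.+ p∸m       ≡⟨ regroup₂ e u qr d p∸m ⟩
          (e ℕ.+ d) ℕ.* u ℕ.* qr ℕ.+ p∸m                     ≡⟨ cong (λ x → x ℕ.* u ℕ.* qr ℕ.+ p∸m) e+d≡m∸1 ⟩
          U ℕ.* qr ℕ.+ p∸m                                   ≤⟨ U·qr+p∸m≤b ⟩
          b                                                  ∎
          where
          open ℕ.≤-Reasoning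
          regroup₁ : ∀ e u K d t L a → e ℕ.* u ℕ.* K ℕ.+ d ℕ.* t ℕ.* L ℕ.+ (a ℕ.+ d) ≡ e ℕ.* u ℕ.* K ℕ.+ d ℕ.* (t ℕ.* L ℕ.+ 1) ℕ.+ a
          regroup₁ = NatSolver.solve-∀
          regroup₂ : ∀ e u K d a → e ℕ.* u ℕ.* K ℕ.+ d ℕ.* (u ℕ.* K) ℕ.+ a ≡ (e ℕ.+ d) ℕ.* u ℕ.* K ℕ.+ a
          regroup₂ = NatSolver.solve-∀
        i≤b : p∸m ℕ.+ d ≤ b
        i≤b = ℕ.≤-trans (ℕ.m≤n+m (p∸m ℕ.+ d) (e ℕ.* u ℕ.* qr ℕ.+ d ℕ.* t ℕ.* rp)) key

    W≡0-X : ∀ {b} a c x₀ → + b ≡ a * + qr mod p → + b ≡ c * + rp mod q → a ≡ + x₀ - + u mod p → c ≡ + Zlow mod q →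
                  x₀ ℕ.+ U < p → b ∸ p∸m < x₀ ℕ.* qr → b < Zlow ℕ.* rp → b < p ℕ.* qr → W p q r b ≡ + 0
    W≡0-X {b} a c x₀ b≡aqr b≡crp a≡ c≡Z x₀+U<p b∸p∸m<x₀qr b<Zrp b<pqr =
      Σ<-zero p λ i i<p → shift-vanishes _ (term i i<p)
      where
      term : ∀ i → i < p → i ≤ b → F p q r (b ∸ i) ≡ + 0
      term i i<p with i ℕ.<? p∸m
      ... | yes i<p∸m = F-low a c i b≡aqr b≡crp c≡Z i<p∸m b<Zrp b<pqr
      ... | no  i≮p∸m = high-index {λ i → i ≤ b → F p q r (b ∸ i) ≡ + 0}
                          (λ d d<m i≤b → proj₂ (F-high a c x₀ d d<m i≤b x₀+U<p b<pqr b≡aqr b≡crp a≡ c≡Z)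
                          (ℕ.≤-<-trans (ℕ.∸-monoʳ-≤ b (ℕ.m≤m+n p∸m d))
                            (ℕ.<-≤-trans b∸p∸m<x₀qr (ℕ.≤-trans (ℕ.*-monoˡ-≤ qr (ℕ.m≤m+n x₀ _)) (ℕ.m≤m+n _ _)))))
                        i i<p (ℕ.≮⇒≥ i≮p∸m)

    module Shifted (Kmax : ℕ) (t·rp<u·qr : t ℕ.* rp ℕ.+ 1 ≤ u ℕ.* qr) (U<p : U < p)
                   (Kmax≤Zlow·rp : Kmax ≤ Zlow ℕ.* rp) (Kmax≤p·qr : Kmax ≤ p ℕ.* qr) where

      private
        k∸s<Kmax : ∀ {k} s → k < Kmax → k ∸ s < Kmax
        k∸s<Kmax {k} s k<Kmax = ℕ.≤-<-trans (ℕ.m∸n≤m k s) k<Kmax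

      shift-W≡m : ∀ {k s} Xk Yk xs ys → s ≤ k → k < Kmax →
        + k ≡ Xk * + qr mod p → + k ≡ Yk * + rp mod q → + s ≡ xs * + qr mod p → + s ≡ ys * + rp mod q →
        Xk - xs ≡ + 0 - + u mod p → Yk - ys ≡ + Zlow mod q → U ℕ.* qr ℕ.+ p∸m ≤ k ∸ s → shift s (W p q r) k ≡ + m
      shift-W≡m {k} {s} Xk Yk xs ys s≤k k<Kmax k≡X k≡Y s≡x s≡y X≡ Y≡ U·qr+p∸m≤k∸s =
        trans (shift-≤ _ s≤k)
          (W≡m (Xk - xs) (Yk - ys) (mod-∸-* Xk xs s≤k k≡X s≡x) (mod-∸-* Yk ys s≤k k≡Y s≡y) X≡ Y≡ U·qr+p∸m≤k∸s
               t·rp<u·qr U<p (ℕ.<-≤-trans (k∸s<Kmax s k<Kmax) Kmax≤Zlow·rp) (ℕ.<-≤-trans (k∸s<Kmax s k<Kmax) Kmax≤p·qr))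

      shift-W≡0-X : ∀ {k s} Xk Yk xs ys x₀ → k < Kmax →
        + k ≡ Xk * + qr mod p → + k ≡ Yk * + rp mod q → + s ≡ xs * + qr mod p → + s ≡ ys * + rp mod q →
        Xk - xs ≡ + x₀ - + u mod p → Yk - ys ≡ + Zlow mod q → x₀ ℕ.+ U < p → (s ≤ k → (k ∸ s) ∸ p∸m < x₀ ℕ.* qr) →
        shift s (W p q r) k ≡ + 0
      shift-W≡0-X {k} {s} Xk Yk xs ys x₀ k<Kmax k≡X k≡Y s≡x s≡y X≡ Y≡ x₀+U<p k∸s∸p∸m< = shift-vanishes _ λ s≤k →
        W≡0-X (Xk - xs) (Yk - ys) x₀ (mod-∸-* Xk xs s≤k k≡X s≡x) (mod-∸-* Yk ys s≤k k≡Y s≡y) X≡ Y≡ x₀+U<p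
                    (k∸s∸p∸m< s≤k) (ℕ.<-≤-trans (k∸s<Kmax s k<Kmax) Kmax≤Zlow·rp) (ℕ.<-≤-trans (k∸s<Kmax s k<Kmax) Kmax≤p·qr)

      shift-W≡0-Y : ∀ {k s} Xk Yk xs ys Z → k < Kmax →
        + k ≡ Xk * + qr mod p → + k ≡ Yk * + rp mod q → + s ≡ xs * + qr mod p → + s ≡ ys * + rp mod q →
        Yk - ys ≡ + Z mod q → Z ℕ.+ p ℕ.* t ≤ q → Kmax ≤ Z ℕ.* rp → shift s (W p q r) k ≡ + 0
      shift-W≡0-Y {k} {s} Xk Yk xs ys Z k<Kmax k≡X k≡Y s≡x s≡y Y≡ Z+pt≤q Kmax≤Zrp = shift-vanishes _ λ s≤k →
        W≡0-Y (Xk - xs) (Yk - ys) Z (mod-∸-* Xk xs s≤k k≡X s≡x) (mod-∸-* Yk ys s≤k k≡Y s≡y) Y≡ Z+pt≤q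
                  (ℕ.<-≤-trans (k∸s<Kmax s k<Kmax) Kmax≤Zrp) (ℕ.<-≤-trans (k∸s<Kmax s k<Kmax) Kmax≤p·qr)


module Construction (p q r : ℕ) (2<p : 2 < p) (2<q : 2 < q) (2<r : 2 < r)
  (p⊥q : Coprime p q) (q⊥r : Coprime q r) (r⊥p : Coprime r p) (p<r : p < r)
  (u v : ℕ) (v<q : v < q)
  (1≡uqr : + 1 ≡ + u ℤ.* + (q ℕ.* r) mod p) (1≡vrp : + 1 ≡ + v ℤ.* + (r ℕ.* p) mod q)
  (tp²<q : (q ∸ v) ℕ.* (p ℕ.* p) < q)
  (xq xr : ℕ) (xq<p : xq < p)
  (q≡xq·qr : + q ≡ + xq ℤ.* + (q ℕ.* r) mod p) (r≡xr·qr : + r ≡ + xr ℤ.* + (q ℕ.* r) mod p) where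

  open import Data.Integer using (_+_; _-_; _*_; -_)

  1≤p : 1 ≤ p
  1≤p = ℕ.≤-trans (s≤s z≤n) 2<p
  1≤q : 1 ≤ q
  1≤q = ℕ.≤-trans (s≤s z≤n) 2<q
  1≤r : 1 ≤ r
  1≤r = ℕ.≤-trans (s≤s z≤n) 2<r

  open Windows p q r 1≤p 1≤q 1≤r p⊥q q⊥r r⊥p u v v<q 1≡uqr 1≡vrp tp²<q public

  instance
    _ = ℕ.>-nonZero 1≤p
    _ = ℕ.>-nonZero 1≤q
    _ = ℕ.>-nonZero 1≤r

  p²<q : p ℕ.* p < q
  p²<q = ℕ.≤-<-trans (ℕ.m≤n*m (p ℕ.* p) t {{ℕ.>-nonZero 1≤t}}) tp²<q

  p<q : p < q
  p<q = ℕ.≤-<-trans (ℕ.m≤m*n p p) p²<q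

  Q≡W-combination : ∀ k → k < p ℕ.* qr →
    Qcoeff p q r k ≡ (W p q r k - shift r (W p q r) k) - (shift q (W p q r) k - shift (q ℕ.+ r) (W p q r) k)
  Q≡W-combination k k<pqr = Qcoeff-W p q r k 1≤p 1≤q 1≤r (subst (k <_) (sym (ℕ.*-assoc p q r)) k<pqr)

  pq+qr+rp≤3qr : p ℕ.* q ℕ.+ qr ℕ.+ rp ≤ 3 ℕ.* qr
  pq+qr+rp≤3qr = begin
    p ℕ.* q ℕ.+ qr ℕ.+ rp               ≤⟨ ℕ.+-monoˡ-≤ rp (ℕ.+-monoˡ-≤ qr (ℕ.m≤n*m (p ℕ.* q) 2)) ⟩
    2 ℕ.* (p ℕ.* q) ℕ.+ qr ℕ.+ rp        ≡⟨ regroup (2 ℕ.* (p ℕ.* q)) qr rp ⟩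
    2 ℕ.* (p ℕ.* q) ℕ.+ rp ℕ.+ qr        ≤⟨ ℕ.+-monoˡ-≤ qr (2pq+rp≤2qr p q r p²<q p<r) ⟩
    2 ℕ.* qr ℕ.+ qr                      ≡⟨ ℕ.+-comm (2 ℕ.* qr) qr ⟩
    3 ℕ.* qr                             ∎
    where
    open ℕ.≤-Reasoning
    regroup : ∀ a b c → a ℕ.+ b ℕ.+ c ≡ a ℕ.+ c ℕ.+ b
    regroup = NatSolver.solve-∀

  p<pqr : p < p ℕ.* qr
  p<pqr = ℕ.<-≤-trans p<q (ℕ.≤-trans (ℕ.m≤m*n q r) (ℕ.m≤n*m qr p))

  F-below-p : ∀ j → 1 ≤ j → j ≤ p → F p q r j ≡ + 0
  F-below-p j 1≤j j≤p = proj₂ (F-char j X Y (n%ℕd<d (+ j * + u) p) (n%ℕd<d (+ j * + v) q) (ℕ.≤-<-trans j≤p p<pqr) resP resQ) j<Y·rp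
    where
    X = (+ j * + u) %ℕ p
    Y = (+ j * + v) %ℕ q
    resP = mod-unit {K = qr} {w = + u} j 1≡uqr
    resQ = mod-unit {K = rp} {w = + v} j 1≡vrp
    1≤Y : 1 ≤ Y
    1≤Y with Y in Y≡
    ... | zero  = contradiction (ℕ.∣⇒≤ {{ℕ.>-nonZero 1≤j}} (mod0⇒∣ (subst (λ y → + j ≡ + y * + rp mod q) Y≡ resQ)))
                                (ℕ.<⇒≱ (ℕ.≤-<-trans j≤p p<q))
    ... | suc _ = s≤s z≤n
    j<Y·rp : j < X ℕ.* qr ℕ.+ Y ℕ.* rp
    j<Y·rp = ℕ.<-≤-trans (ℕ.≤-<-trans j≤p p<r)
               (ℕ.≤-trans (ℕ.m≤m*n r p) (ℕ.≤-trans (ℕ.m≤n*m rp Y {{ℕ.>-nonZero 1≤Y}}) (ℕ.m≤n+m _ _)))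

  p≤Qdeg : p ≤ Qdeg p q r
  p≤Qdeg = ℕ.m+n≤o⇒m≤o∸n p $ begin
    p ℕ.+ (p ℕ.* q ℕ.+ qr ℕ.+ rp ℕ.+ 1)         ≤⟨ ℕ.+-monoʳ-≤ p (ℕ.+-monoˡ-≤ 1 pq+qr+rp≤3qr) ⟩
    p ℕ.+ (3 ℕ.* qr ℕ.+ 1)                        ≤⟨ ℕ.+-monoʳ-≤ p (ℕ.+-mono-≤ (ℕ.*-monoˡ-≤ qr 2<p) 1≤q) ⟩
    p ℕ.+ (p ℕ.* qr ℕ.+ q)                        ≤⟨ ℕ.m≤m+n _ r ⟩
    p ℕ.+ (p ℕ.* qr ℕ.+ q) ℕ.+ r                  ≡⟨ regroup p q r ⟩
    p ℕ.* q ℕ.* r ℕ.+ p ℕ.+ q ℕ.+ r               ∎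
    where
    open ℕ.≤-Reasoning
    regroup : ∀ p q r → p ℕ.+ (p ℕ.* (q ℕ.* r) ℕ.+ q) ℕ.+ r ≡ p ℕ.* q ℕ.* r ℕ.+ p ℕ.+ q ℕ.+ r
    regroup = NatSolver.solve-∀

  0∈A : InA p q r (+ 0)
  0∈A = p , p≤Qdeg , trans (Q≡W-combination p p<pqr)
    (cong₂ _-_ (cong₂ _-_ W≡0 (shift-> _ p<r)) (cong₂ _-_ (shift-> _ p<q) (shift-> _ (ℕ.<-≤-trans p<q (ℕ.m≤m+n q r)))))
    where
    W≡0 : W p q r p ≡ + 0
    W≡0 = Σ<-zero p λ i i<p → trans (shift-≤ _ (ℕ.<⇒≤ i<p)) (F-below-p (p ∸ i) (ℕ.m<n⇒0<n∸m i<p) (ℕ.m∸n≤m p i))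

  σ : ℕ
  σ = (+ r * + t) %ℕ q

  σ<q : σ < q
  σ<q = n%ℕd<d (+ r * + t) q

  rt≡σ : + r * + t ≡ + σ mod q
  rt≡σ = %ℕ-mod (+ r * + t) q

  q∣pσ+1 : q ℕ.∣ p ℕ.* σ ℕ.+ 1
  q∣pσ+1 = mod0⇒∣ (mod-trans (mod-respʳ rearrange (mod-+ pσ≡prt 1≡vrp)) (multiple-mod0 (+ rp) q))
    where
    pσ≡prt : + (p ℕ.* σ) ≡ + p * (+ r * + t) mod q
    pσ≡prt = mod-respˡ (sym (ℤ.pos-* p σ)) (mod-* (+ p) (mod-sym rt≡σ))
    regroup : ∀ p r t v k → p * (r * t) + v * k ≡ (r * p) * t + v * k
    regroup = solve-∀
    factor : ∀ k t v → k * t + v * k ≡ k * (v + t)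
    factor = solve-∀
    rearrange : + p * (+ r * + t) + + v * + rp ≡ + rp * + q
    rearrange = begin
      + p * (+ r * + t) + + v * + rp   ≡⟨ regroup (+ p) (+ r) (+ t) (+ v) (+ rp) ⟩
      (+ r * + p) * + t + + v * + rp   ≡⟨ cong (λ z → z * + t + + v * + rp) (sym (ℤ.pos-* r p)) ⟩
      + rp * + t + + v * + rp          ≡⟨ factor (+ rp) (+ t) (+ v) ⟩
      + rp * (+ v + + t)               ≡⟨ cong (+ rp *_) v+t≡q ⟩
      + rp * + q                       ∎
      where open ≡-Reasoning

  q≤pσ+1 : q ≤ p ℕ.* σ ℕ.+ 1
  q≤pσ+1 = ℕ.∣⇒≤ {{ℕ.>-nonZero (ℕ.m≤n+m 1 (p ℕ.* σ))}} q∣pσ+1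

  pσ+1≤pq : p ℕ.* σ ℕ.+ 1 ≤ p ℕ.* q
  pσ+1≤pq = ℕ.≤-trans (ℕ.+-monoʳ-≤ (p ℕ.* σ) 1≤p)
              (ℕ.≤-trans (ℕ.≤-reflexive (trans (ℕ.+-comm (p ℕ.* σ) p) (sym (ℕ.*-suc p σ)))) (ℕ.*-monoʳ-≤ p σ<q))

  q∣p[q∸σ]∸1 : q ℕ.∣ p ℕ.* (q ∸ σ) ∸ 1
  q∣p[q∸σ]∸1 = subst (q ℕ.∣_) (sym rearrange) (∣m∣n⇒∣m∸n pσ+1≤pq (ℕ.n∣m*n p) q∣pσ+1)
    where
    rearrange : p ℕ.* (q ∸ σ) ∸ 1 ≡ p ℕ.* q ∸ (p ℕ.* σ ℕ.+ 1)
    rearrange = trans (cong (_∸ 1) (ℕ.*-distribˡ-∸ p q σ)) (ℕ.∸-+-assoc (p ℕ.* q) (p ℕ.* σ) 1)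

  q≤p[q∸σ]∸1 : q ≤ p ℕ.* (q ∸ σ) ∸ 1
  q≤p[q∸σ]∸1 = ℕ.∣⇒≤ {{ℕ.>-nonZero 1≤p[q∸σ]∸1}} q∣p[q∸σ]∸1
    where
    1≤p[q∸σ]∸1 : 1 ≤ p ℕ.* (q ∸ σ) ∸ 1
    1≤p[q∸σ]∸1 = ℕ.m+n≤o⇒m≤o∸n 1 (ℕ.≤-trans (ℕ.<⇒≤ 2<p) (ℕ.m≤m*n p (q ∸ σ) {{ℕ.>-nonZero (ℕ.m<n⇒0<n∸m σ<q)}}))

  0≡0·qr : + 0 ≡ + 0 * + qr mod p
  0≡0·qr = mod-reflexive refl
  0≡0·rp : + 0 ≡ + 0 * + rp mod q
  0≡0·rp = mod-reflexive refl
  q≡0·rp : + q ≡ + 0 * + rp mod q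
  q≡0·rp = ∣⇒mod0 ℕ.∣-refl
  r≡rv·rp : + r ≡ (+ r * + v) * + rp mod q
  r≡rv·rp = mod-respˡ (ℤ.*-identityʳ (+ r)) (mod-respʳ (sym (ℤ.*-assoc (+ r) (+ v) (+ rp))) (mod-* (+ r) 1≡vrp))
  q+r≡[xq+xr]·qr : + (q ℕ.+ r) ≡ (+ xq + + xr) * + qr mod p
  q+r≡[xq+xr]·qr = mod-respʳ (sym (ℤ.*-distribʳ-+ (+ qr) (+ xq) (+ xr))) (mod-+ q≡xq·qr r≡xr·qr)
  q+r≡rv·rp : + (q ℕ.+ r) ≡ (+ r * + v) * + rp mod q
  q+r≡rv·rp = mod-respʳ (ℤ.+-identityˡ _) (mod-+ q≡0·rp r≡rv·rp)

  module Target (m : ℕ) (1≤m : 1 ≤ m) (1≤u : 1 ≤ u) (m·u≤xq : m ℕ.* u ≤ xq) (m·u≤p∸xq : m ℕ.* u ≤ p ∸ xq) where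

    m≤p : m ≤ p
    m≤p = ℕ.≤-trans (ℕ.m≤m*n m u {{ℕ.>-nonZero 1≤u}}) (ℕ.≤-trans m·u≤xq (ℕ.<⇒≤ xq<p))

    open Window m 1≤m m≤p public

    U+1≤m·u : U ℕ.+ 1 ≤ m ℕ.* u
    U+1≤m·u = ℕ.≤-trans (ℕ.+-monoʳ-≤ U 1≤u) (ℕ.≤-reflexive (trans (fold (m ∸ 1) u) (cong (ℕ._* u) (ℕ.m∸n+n≡m 1≤m))))
      where
      fold : ∀ a u → a ℕ.* u ℕ.+ u ≡ (a ℕ.+ 1) ℕ.* u
      fold = NatSolver.solve-∀

    U<m·u : U < m ℕ.* u
    U<m·u = subst (_≤ m ℕ.* u) (ℕ.+-comm U 1) U+1≤m·u

    U<p : U < p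
    U<p = ℕ.<-≤-trans U<m·u (ℕ.≤-trans m·u≤xq (ℕ.<⇒≤ xq<p))

    2[U+1]≤p : (U ℕ.+ 1) ℕ.+ (U ℕ.+ 1) ≤ p
    2[U+1]≤p = ℕ.≤-trans (ℕ.+-mono-≤ U+1≤m·u U+1≤m·u)
                         (ℕ.≤-trans (ℕ.+-mono-≤ m·u≤xq m·u≤p∸xq) (ℕ.≤-reflexive (ℕ.m+[n∸m]≡n (ℕ.<⇒≤ xq<p))))

    U+3≤p : U ℕ.+ 3 ≤ p
    U+3≤p = go U 2[U+1]≤p
      where
      go : ∀ U → (U ℕ.+ 1) ℕ.+ (U ℕ.+ 1) ≤ p → U ℕ.+ 3 ≤ p
      go zero    _   = 2<p
      go (suc U) 2U+2≤p = ℕ.≤-trans (ℕ.≤-trans (ℕ.m≤m+n (suc U ℕ.+ 3) U) (ℕ.≤-reflexive (expand U))) 2U+2≤p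
        where
        expand : ∀ U → suc U ℕ.+ 3 ℕ.+ U ≡ (suc U ℕ.+ 1) ℕ.+ (suc U ℕ.+ 1)
        expand = NatSolver.solve-∀

    p·[p∸m]t<q : p ℕ.* (p∸m ℕ.* t) < q
    p·[p∸m]t<q = ℕ.≤-<-trans (ℕ.≤-trans (ℕ.*-monoʳ-≤ p (ℕ.*-monoˡ-≤ t (ℕ.m∸n≤m p m))) (ℕ.≤-reflexive (swap p t))) tp²<q
      where
      swap : ∀ p t → p ℕ.* (p ℕ.* t) ≡ t ℕ.* (p ℕ.* p)
      swap = NatSolver.solve-∀

    p·mt<q : p ℕ.* (m ℕ.* t) < q
    p·mt<q = ℕ.≤-<-trans (ℕ.≤-trans (ℕ.*-monoʳ-≤ p (ℕ.*-monoˡ-≤ t m≤p)) (ℕ.≤-reflexive (swap p t))) tp²<q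
      where
      swap : ∀ p t → p ℕ.* (p ℕ.* t) ≡ t ℕ.* (p ℕ.* p)
      swap = NatSolver.solve-∀

    Kmax : ℕ
    Kmax = q ℕ.+ r ℕ.+ (U ℕ.* qr ℕ.+ p∸m) ℕ.+ p ℕ.* q

    t·rp+1≤u·qr : t ℕ.* rp ℕ.+ 1 ≤ u ℕ.* qr
    t·rp+1≤u·qr = t·rp<u·qr t p q r u (subst (_< q) (ℕ.*-comm p t) pt<q) 1≤u 1≤r

    Kmax≤Zlow·rp : Kmax ≤ Zlow ℕ.* rp
    Kmax≤Zlow·rp = begin
      Kmax                                           ≡⟨ regroup q r (U ℕ.* qr) p∸m (p ℕ.* q) ⟩
      U ℕ.* qr ℕ.+ ((p ℕ.* q ℕ.+ q) ℕ.+ p∸m) ℕ.+ r   ≤⟨ ℕ.+-monoˡ-≤ r (ℕ.+-monoʳ-≤ (U ℕ.* qr) (ℕ.+-mono-≤ (pq+q≤qr p q r p<r) p∸m≤qr)) ⟩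
      U ℕ.* qr ℕ.+ (qr ℕ.+ qr) ℕ.+ r                 ≡⟨ cong (ℕ._+ r) (fold U qr) ⟩
      (U ℕ.+ 2) ℕ.* qr ℕ.+ r
        ≤⟨ ℕ.+-monoˡ-≤ r (ℕ.*-monoˡ-≤ qr (ℕ.m+n≤o⇒m≤o∸n (U ℕ.+ 2) (subst (_≤ p) (shuffle U) U+3≤p))) ⟩
      (p ∸ 1) ℕ.* qr ℕ.+ r                           ≤⟨ pred-p·qr+r≤[q∸w]·rp p q r (p∸m ℕ.* t) 1≤p p·[p∸m]t<q ⟩
      Zlow ℕ.* rp                                    ∎
      where
      open ℕ.≤-Reasoning
      regroup : ∀ q r a l b → q ℕ.+ r ℕ.+ (a ℕ.+ l) ℕ.+ b ≡ a ℕ.+ ((b ℕ.+ q) ℕ.+ l) ℕ.+ r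
      regroup = NatSolver.solve-∀
      fold : ∀ U k → U ℕ.* k ℕ.+ (k ℕ.+ k) ≡ (U ℕ.+ 2) ℕ.* k
      fold = NatSolver.solve-∀
      shuffle : ∀ U → U ℕ.+ 3 ≡ U ℕ.+ 2 ℕ.+ 1
      shuffle = NatSolver.solve-∀
      p∸m≤qr : p∸m ≤ qr
      p∸m≤qr = ℕ.≤-trans (ℕ.m∸n≤m p m) (ℕ.≤-trans (ℕ.<⇒≤ p<q) (ℕ.m≤m*n q r))

    Kmax≤p·qr : Kmax ≤ p ℕ.* qr
    Kmax≤p·qr = ℕ.≤-trans Kmax≤Zlow·rp (ℕ.≤-trans (ℕ.*-monoˡ-≤ rp (ℕ.m∸n≤m q (p∸m ℕ.* t))) (ℕ.≤-reflexive (swap p q r)))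
      where
      swap : ∀ p q r → q ℕ.* (r ℕ.* p) ≡ p ℕ.* (q ℕ.* r)
      swap = NatSolver.solve-∀

    <Kmax⇒≤Qdeg : ∀ {k} → k < Kmax → k ≤ Qdeg p q r
    <Kmax⇒≤Qdeg {k} k<Kmax = ℕ.m+n≤o⇒m≤o∸n k $ begin
      k ℕ.+ (p ℕ.* q ℕ.+ qr ℕ.+ rp ℕ.+ 1)                   ≡⟨ shift-one k (p ℕ.* q ℕ.+ qr ℕ.+ rp) ⟩
      suc k ℕ.+ (p ℕ.* q ℕ.+ qr ℕ.+ rp)                      ≤⟨ ℕ.+-monoˡ-≤ _ k<Kmax ⟩
      Kmax ℕ.+ (p ℕ.* q ℕ.+ qr ℕ.+ rp)                       ≡⟨ regroup q r U qr p∸m (p ℕ.* q) rp ⟩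
      (p∸m ℕ.+ q ℕ.+ r) ℕ.+ ((U ℕ.+ 1) ℕ.* qr ℕ.+ (2 ℕ.* (p ℕ.* q) ℕ.+ rp))
        ≤⟨ ℕ.+-mono-≤ (ℕ.+-monoˡ-≤ r (ℕ.+-monoˡ-≤ q (ℕ.m∸n≤m p m))) (ℕ.+-monoʳ-≤ ((U ℕ.+ 1) ℕ.* qr) (2pq+rp≤2qr p q r p²<q p<r)) ⟩
      (p ℕ.+ q ℕ.+ r) ℕ.+ ((U ℕ.+ 1) ℕ.* qr ℕ.+ 2 ℕ.* qr)     ≡⟨ cong (p ℕ.+ q ℕ.+ r ℕ.+_) (fold U qr) ⟩
      (p ℕ.+ q ℕ.+ r) ℕ.+ (U ℕ.+ 3) ℕ.* qr                   ≤⟨ ℕ.+-monoʳ-≤ (p ℕ.+ q ℕ.+ r) (ℕ.*-monoˡ-≤ qr U+3≤p) ⟩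
      (p ℕ.+ q ℕ.+ r) ℕ.+ p ℕ.* qr                           ≡⟨ reassoc p q r ⟩
      p ℕ.* q ℕ.* r ℕ.+ p ℕ.+ q ℕ.+ r                       ∎
      where
      open ℕ.≤-Reasoning
      shift-one : ∀ k a → k ℕ.+ (a ℕ.+ 1) ≡ suc k ℕ.+ a
      shift-one = NatSolver.solve-∀
      regroup : ∀ q r U k l b d → q ℕ.+ r ℕ.+ (U ℕ.* k ℕ.+ l) ℕ.+ b ℕ.+ (b ℕ.+ k ℕ.+ d) ≡
                                  (l ℕ.+ q ℕ.+ r) ℕ.+ ((U ℕ.+ 1) ℕ.* k ℕ.+ (2 ℕ.* b ℕ.+ d))
      regroup = NatSolver.solve-∀
      fold : ∀ U k → (U ℕ.+ 1) ℕ.* k ℕ.+ 2 ℕ.* k ≡ (U ℕ.+ 3) ℕ.* k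
      fold = NatSolver.solve-∀
      reassoc : ∀ p q r → (p ℕ.+ q ℕ.+ r) ℕ.+ p ℕ.* (q ℕ.* r) ≡ p ℕ.* q ℕ.* r ℕ.+ p ℕ.+ q ℕ.+ r
      reassoc = NatSolver.solve-∀

    open Shifted Kmax t·rp+1≤u·qr U<p Kmax≤Zlow·rp Kmax≤p·qr public

    base : ℕ → ℕ
    base s = s ℕ.+ (U ℕ.* qr ℕ.+ p∸m)

    -- Given residues x, y of a shift s, a k found by the Chinese remainder theorem at which
    -- the window W(k - s) is one evaluated by W≡m.
    record Point (s : ℕ) (x y : ℤ) : Set where
      field
        k         : ℕ
        base≤k    : base s ≤ k
        k<base+pq : k < base s ℕ.+ p ℕ.* q
        k<Kmax    : k < Kmax
        k≡X       : + k ≡ (x - + u) * + qr mod p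
        k≡Y       : + k ≡ (y + + Zlow) * + rp mod q

    point : ∀ s x y → s ≤ q ℕ.+ r → Point s x y
    point s x y s≤q+r = build (mod-representative (base s) T (p ℕ.* q) {{ℕ.>-nonZero (ℕ.*-mono-≤ 1≤p 1≤q)}})
      where
      T = (x - + u) * + qr + (y + + Zlow) * + rp
      build : Σ ℕ (λ k → base s ≤ k × k < base s ℕ.+ p ℕ.* q × + k ≡ T mod (p ℕ.* q)) → Point s x y
      build (k , base≤k , k<base+pq , k≡T) = record
        { k = k ; base≤k = base≤k ; k<base+pq = k<base+pq
        ; k<Kmax = ℕ.<-≤-trans k<base+pq (ℕ.+-monoˡ-≤ (p ℕ.* q) (ℕ.+-monoˡ-≤ (U ℕ.* qr ℕ.+ p∸m) s≤q+r))
        ; k≡X = mod-trans (mod-∣ (ℕ.m∣m*n q) k≡T)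
                  (mod-respʳ (trans (cong (λ z → (x - + u) * + qr + z) (ℤ.*-zeroʳ (y + + Zlow))) (ℤ.+-identityʳ _))
                    (mod-+ (mod-reflexive {b = (x - + u) * + qr} refl) (mod-* (y + + Zlow) (∣⇒mod0 (ℕ.n∣m*n r)))))
        ; k≡Y = mod-trans (mod-∣ (ℕ.n∣m*n p) k≡T)
                  (mod-respʳ (trans (cong (_+ (y + + Zlow) * + rp) (ℤ.*-zeroʳ (x - + u))) (ℤ.+-identityˡ _))
                    (mod-+ (mod-* (x - + u) (∣⇒mod0 (ℕ.m∣m*n r))) (mod-reflexive {b = (y + + Zlow) * + rp} refl)))
        }

    record LargeY (y : ℤ) : Set where
      field
        Z         : ℕ
        y≡Z       : y ≡ + Z mod q
        Z+pt≤q    : Z ℕ.+ p ℕ.* t ≤ q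
        Kmax≤Z·rp : Kmax ≤ Z ℕ.* rp

    module AtPoint {s x y} (pt : Point s x y) where
      open Point pt public

      window-m : + s ≡ x * + qr mod p → + s ≡ y * + rp mod q → shift s (W p q r) k ≡ + m
      window-m s≡x s≡y = shift-W≡m (x - + u) (y + + Zlow) x y s≤k k<Kmax k≡X k≡Y s≡x s≡y
        (mod-reflexive (cancel₁ x (+ u))) (mod-reflexive (cancel₂ y (+ Zlow))) (+≤⇒≤∸ {n = s} base≤k)
        where
        s≤k = ℕ.m+n≤o⇒m≤o s base≤k
        cancel₁ : ∀ x u → (x - u) - x ≡ + 0 - u
        cancel₁ = solve-∀
        cancel₂ : ∀ y z → (y + z) - y ≡ z
        cancel₂ = solve-∀

      window-0-X : ∀ {s′} x′ y′ x₀ → + s′ ≡ x′ * + qr mod p → + s′ ≡ y′ * + rp mod q →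
                   x - x′ ≡ + x₀ mod p → y ≡ y′ mod q → m ℕ.* u ≤ x₀ → x₀ ℕ.+ U < p → s ≤ s′ ℕ.+ q →
                   shift s′ (W p q r) k ≡ + 0
      window-0-X {s′} x′ y′ x₀ s′≡x′ s′≡y′ x-x′≡x₀ y≡y′ m·u≤x₀ x₀+U<p s≤s′+q =
        shift-W≡0-X (x - + u) (y + + Zlow) x′ y′ x₀ k<Kmax k≡X k≡Y s′≡x′ s′≡y′
          (mod-respˡ (regroup₁ x (+ u) x′) (mod-sub x-x′≡x₀ (mod-reflexive {b = + u} refl)))
          (mod-respˡ (regroup₂ y (+ Zlow) y′) (mod-respʳ (cancel y′ (+ Zlow))
            (mod-+ (mod-sub y≡y′ (mod-reflexive {b = y′} refl)) (mod-reflexive {b = + Zlow} refl))))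
          x₀+U<p (λ _ → far)
        where
        regroup₁ : ∀ x u x′ → (x - x′) - u ≡ (x - u) - x′
        regroup₁ = solve-∀
        regroup₂ : ∀ y z y′ → (y - y′) + z ≡ (y + z) - y′
        regroup₂ = solve-∀
        cancel : ∀ a z → (a - a) + z ≡ z
        cancel = solve-∀
        B = U ℕ.* qr ℕ.+ p ℕ.* q ℕ.+ q
        k<s′+p∸m+B : k < s′ ℕ.+ p∸m ℕ.+ B
        k<s′+p∸m+B = ℕ.<-≤-trans k<base+pq (ℕ.≤-trans (ℕ.+-monoˡ-≤ (p ℕ.* q) (ℕ.+-monoˡ-≤ (U ℕ.* qr ℕ.+ p∸m) s≤s′+q))
                                                   (ℕ.≤-reflexive (regroup s′ q U qr p∸m (p ℕ.* q))))
          where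
          regroup : ∀ a q U k l b → a ℕ.+ q ℕ.+ (U ℕ.* k ℕ.+ l) ℕ.+ b ≡ a ℕ.+ l ℕ.+ (U ℕ.* k ℕ.+ b ℕ.+ q)
          regroup = NatSolver.solve-∀
        far : (k ∸ s′) ∸ p∸m < x₀ ℕ.* qr
        far = begin-strict
          (k ∸ s′) ∸ p∸m                 ≡⟨ ℕ.∸-+-assoc k s′ p∸m ⟩
          k ∸ (s′ ℕ.+ p∸m)               <⟨ ℕ.m<n+o⇒m∸n<o k (s′ ℕ.+ p∸m) {{ℕ.>-nonZero (ℕ.≤-trans 1≤q (ℕ.m≤n+m q _))}} k<s′+p∸m+B ⟩
          U ℕ.* qr ℕ.+ p ℕ.* q ℕ.+ q     ≡⟨ ℕ.+-assoc (U ℕ.* qr) (p ℕ.* q) q ⟩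
          U ℕ.* qr ℕ.+ (p ℕ.* q ℕ.+ q)   ≤⟨ ℕ.+-monoʳ-≤ (U ℕ.* qr) (pq+q≤qr p q r p<r) ⟩
          U ℕ.* qr ℕ.+ qr                ≡⟨ fold U qr ⟩
          (U ℕ.+ 1) ℕ.* qr               ≤⟨ ℕ.*-monoˡ-≤ qr (ℕ.≤-trans U+1≤m·u m·u≤x₀) ⟩
          x₀ ℕ.* qr                      ∎
          where
          open ℕ.≤-Reasoning
          fold : ∀ U k → U ℕ.* k ℕ.+ k ≡ (U ℕ.+ 1) ℕ.* k
          fold = NatSolver.solve-∀

      window-0-Y : ∀ {s′} x′ y′ → + s′ ≡ x′ * + qr mod p → + s′ ≡ y′ * + rp mod q → LargeY ((y + + Zlow) - y′) →
                   shift s′ (W p q r) k ≡ + 0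
      window-0-Y x′ y′ s′≡x′ s′≡y′ large =
        shift-W≡0-Y (x - + u) (y + + Zlow) x′ y′ Z k<Kmax k≡X k≡Y s′≡x′ s′≡y′ y≡Z Z+pt≤q Kmax≤Z·rp
        where open LargeY large

    ∈A-from-windows : ∀ {k a b c d} → k < Kmax →
         shift 0 (W p q r) k ≡ a → shift r (W p q r) k ≡ b → shift q (W p q r) k ≡ c → shift (q ℕ.+ r) (W p q r) k ≡ d →
         InA p q r ((a - b) - (c - d))
    ∈A-from-windows {k} k<Kmax W₀ Wr Wq Wqr = k , <Kmax⇒≤Qdeg k<Kmax ,
      trans (Q≡W-combination k (ℕ.<-≤-trans k<Kmax Kmax≤p·qr))
            (cong₂ _-_ (cong₂ _-_ (trans (sym (shift-zero (W p q r) k)) W₀) Wr) (cong₂ _-_ Wq Wqr))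

    -xq≡p∸xq : ∀ a → a - + xq ≡ a + + (p ∸ xq) mod p
    -xq≡p∸xq a = ≡mod (divides (ℤ.- + 1) (trans (cong (λ z → (a - + xq) - (a + z)) (pos-∸ (ℕ.<⇒≤ xq<p))) (cancel a (+ xq) (+ p))))
      where
      cancel : ∀ a x p → (a - x) - (a + (p - x)) ≡ ℤ.- + 1 * p
      cancel = solve-∀

    p∸xq+U<p : (p ∸ xq) ℕ.+ U < p
    p∸xq+U<p = ℕ.<-≤-trans (ℕ.+-monoʳ-< (p ∸ xq) (ℕ.<-≤-trans U<m·u m·u≤xq)) (ℕ.≤-reflexive (ℕ.m∸n+n≡m (ℕ.<⇒≤ xq<p)))

    xq+U<p : xq ℕ.+ U < p
    xq+U<p = ℕ.<-≤-trans (ℕ.+-monoʳ-< xq (ℕ.<-≤-trans U<m·u m·u≤p∸xq)) (ℕ.≤-reflexive (ℕ.m+[n∸m]≡n (ℕ.<⇒≤ xq<p)))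

    +m∈A-below : LargeY ((+ 0 + + Zlow) - + r * + v) → InA p q r (+ m)
    +m∈A-below large = subst (InA p q r) (value (+ m)) (∈A-from-windows k<Kmax
      (window-m 0≡0·qr 0≡0·rp)
      (window-0-Y (+ xr) (+ r * + v) r≡xr·qr r≡rv·rp large)
      (window-0-X (+ xq) (+ 0) (p ∸ xq) q≡xq·qr q≡0·rp (-xq≡p∸xq (+ 0)) (mod-reflexive refl) m·u≤p∸xq p∸xq+U<p z≤n)
      (window-0-Y (+ xq + + xr) (+ r * + v) q+r≡[xq+xr]·qr q+r≡rv·rp large))
      where
      open AtPoint (point 0 (+ 0) (+ 0) z≤n)
      value : ∀ a → (a - + 0) - (+ 0 - + 0) ≡ a
      value = solve-∀

    -m∈A-below : LargeY ((+ 0 + + Zlow) - + r * + v) → InA p q r (- + m)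
    -m∈A-below large = subst (InA p q r) (value (+ m)) (∈A-from-windows k<Kmax
      (window-0-X (+ 0) (+ 0) xq 0≡0·qr 0≡0·rp (mod-reflexive (ℤ.+-identityʳ (+ xq))) (mod-reflexive refl) m·u≤xq xq+U<p (ℕ.m≤n+m q 0))
      (window-0-Y (+ xr) (+ r * + v) r≡xr·qr r≡rv·rp large)
      (window-m q≡xq·qr q≡0·rp)
      (window-0-Y (+ xq + + xr) (+ r * + v) q+r≡[xq+xr]·qr q+r≡rv·rp large))
      where
      open AtPoint (point q (+ xq) (+ 0) (ℕ.m≤m+n q r))
      value : ∀ a → (+ 0 - + 0) - (a - + 0) ≡ - a
      value = solve-∀

    +m∈A-above : LargeY ((+ r * + v + + Zlow) - + 0) → InA p q r (+ m)
    +m∈A-above large = subst (InA p q r) (value (+ m)) (∈A-from-windows k<Kmax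
      (window-0-Y (+ 0) (+ 0) 0≡0·qr 0≡0·rp large)
      (window-0-X (+ xr) (+ r * + v) xq r≡xr·qr r≡rv·rp (mod-reflexive (cancel (+ xq) (+ xr))) (mod-reflexive refl)
              m·u≤xq xq+U<p (ℕ.≤-reflexive (ℕ.+-comm q r)))
      (window-0-Y (+ xq) (+ 0) q≡xq·qr q≡0·rp large)
      (window-m q+r≡[xq+xr]·qr q+r≡rv·rp))
      where
      open AtPoint (point (q ℕ.+ r) (+ xq + + xr) (+ r * + v) ℕ.≤-refl)
      value : ∀ a → (+ 0 - + 0) - (+ 0 - a) ≡ a
      value = solve-∀
      cancel : ∀ a b → (a + b) - b ≡ a
      cancel = solve-∀

    -m∈A-above : LargeY ((+ r * + v + + Zlow) - + 0) → InA p q r (- + m)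
    -m∈A-above large = subst (InA p q r) (value (+ m)) (∈A-from-windows k<Kmax
      (window-0-Y (+ 0) (+ 0) 0≡0·qr 0≡0·rp large)
      (window-m r≡xr·qr r≡rv·rp)
      (window-0-Y (+ xq) (+ 0) q≡xq·qr q≡0·rp large)
      (window-0-X (+ xq + + xr) (+ r * + v) (p ∸ xq) q+r≡[xq+xr]·qr q+r≡rv·rp
              (mod-respˡ (sym (cancel (+ xq) (+ xr))) (-xq≡p∸xq (+ 0))) (mod-reflexive refl) m·u≤p∸xq p∸xq+U<p
              (ℕ.≤-trans (ℕ.m≤n+m r q) (ℕ.m≤m+n (q ℕ.+ r) q))))
      where
      open AtPoint (point r (+ xr) (+ r * + v) (ℕ.m≤n+m r q))
      value : ∀ a → (+ 0 - a) - (+ 0 - + 0) ≡ - a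
      value = solve-∀
      cancel : ∀ a b → b - (a + b) ≡ + 0 - a
      cancel = solve-∀

    large-Y : ∀ {y} σ₁ → (U ℕ.+ 2) ℕ.* q ≤ p ℕ.* σ₁ ℕ.+ 1 → σ₁ ℕ.+ m ℕ.* t ≤ q →
              (p∸m ℕ.* t ≤ σ₁ → y ≡ + (σ₁ ∸ p∸m ℕ.* t) mod q) → LargeY y
    large-Y σ₁ [U+2]q≤pσ₁+1 σ₁+mt≤q y≡ = record
      { Z = σ₁ ∸ w ; y≡Z = y≡ w≤σ₁ ; Z+pt≤q = ℕ.≤-trans (ℕ.≤-reflexive Z+pt≡σ₁+mt) σ₁+mt≤q ; Kmax≤Z·rp = Kmax≤Z·rp }
      where
      w = p∸m ℕ.* t
      w≤σ₁ : w ≤ σ₁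
      w≤σ₁ = ℕ.*-cancelˡ-≤ p {{ℕ.>-nonZero 1≤p}} (ℕ.+-cancelʳ-≤ 1 _ _ (ℕ.≤-trans p·[p∸m]t<q′ [U+2]q≤pσ₁+1))
        where
        p·[p∸m]t<q′ : p ℕ.* w ℕ.+ 1 ≤ (U ℕ.+ 2) ℕ.* q
        p·[p∸m]t<q′ = ℕ.≤-trans (subst (_≤ q) (ℕ.+-comm 1 _) p·[p∸m]t<q)
                                (ℕ.m≤n*m q (U ℕ.+ 2) {{ℕ.>-nonZero (ℕ.≤-trans (s≤s z≤n) (ℕ.m≤n+m 2 U))}})
      Z+pt≡σ₁+mt : (σ₁ ∸ w) ℕ.+ p ℕ.* t ≡ σ₁ ℕ.+ m ℕ.* t
      Z+pt≡σ₁+mt = begin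
        (σ₁ ∸ w) ℕ.+ p ℕ.* t               ≡⟨ cong (λ x → (σ₁ ∸ w) ℕ.+ x ℕ.* t) (sym p∸m+m≡p) ⟩
        (σ₁ ∸ w) ℕ.+ (p∸m ℕ.+ m) ℕ.* t     ≡⟨ cong ((σ₁ ∸ w) ℕ.+_) (ℕ.*-distribʳ-+ t p∸m m) ⟩
        (σ₁ ∸ w) ℕ.+ (w ℕ.+ m ℕ.* t)       ≡⟨ sym (ℕ.+-assoc (σ₁ ∸ w) w (m ℕ.* t)) ⟩
        (σ₁ ∸ w) ℕ.+ w ℕ.+ m ℕ.* t         ≡⟨ cong (ℕ._+ m ℕ.* t) (ℕ.m∸n+n≡m w≤σ₁) ⟩
        σ₁ ℕ.+ m ℕ.* t                     ∎
        where open ≡-Reasoning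
      pw+p≤q∸1 : p ℕ.* w ℕ.+ p ≤ q ∸ 1
      pw+p≤q∸1 = ℕ.m+n≤o⇒m≤o∸n _ $ begin
        p ℕ.* w ℕ.+ p ℕ.+ 1           ≡⟨ cong (ℕ._+ 1) (trans (ℕ.+-comm (p ℕ.* w) p) (sym (ℕ.*-suc p w))) ⟩
        p ℕ.* suc w ℕ.+ 1             ≤⟨ ℕ.+-monoˡ-≤ 1 (ℕ.*-monoʳ-≤ p suc-w≤pt) ⟩
        p ℕ.* (p ℕ.* t) ℕ.+ 1         ≡⟨ cong (ℕ._+ 1) (swap p t) ⟩
        t ℕ.* (p ℕ.* p) ℕ.+ 1         ≡⟨ ℕ.+-comm _ 1 ⟩
        suc (t ℕ.* (p ℕ.* p))         ≤⟨ tp²<q ⟩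
        q                             ∎
        where
        open ℕ.≤-Reasoning
        swap : ∀ p t → p ℕ.* (p ℕ.* t) ≡ t ℕ.* (p ℕ.* p)
        swap = NatSolver.solve-∀
        suc-w≤pt : suc w ≤ p ℕ.* t
        suc-w≤pt = begin
          suc (p∸m ℕ.* t)       ≤⟨ ℕ.+-monoˡ-≤ (p∸m ℕ.* t) 1≤t ⟩
          t ℕ.+ p∸m ℕ.* t       ≡⟨⟩
          suc p∸m ℕ.* t         ≤⟨ ℕ.*-monoˡ-≤ t (subst (suc p∸m ≤_) p∸m+m≡p (subst (_≤ p∸m ℕ.+ m) (ℕ.+-comm p∸m 1) (ℕ.+-monoʳ-≤ p∸m 1≤m))) ⟩
          p ℕ.* t               ∎
      margin : (U ℕ.+ 1) ℕ.* q ℕ.+ p ≤ p ℕ.* (σ₁ ∸ w)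
      margin = subst (λ Q → (U ℕ.+ 1) ℕ.* Q ℕ.+ p ≤ p ℕ.* (σ₁ ∸ w)) q∸1+1≡q
        (window-margin p U (σ₁ ∸ w) w (q ∸ 1) pw+p≤q∸1
          (subst₂ (λ Q σ → (U ℕ.+ 2) ℕ.* Q ≤ p ℕ.* σ ℕ.+ 1) (sym q∸1+1≡q) (sym (ℕ.m∸n+n≡m w≤σ₁)) [U+2]q≤pσ₁+1))
        where
        q∸1+1≡q : q ∸ 1 ℕ.+ 1 ≡ q
        q∸1+1≡q = ℕ.m∸n+n≡m 1≤q
      Kmax≤Z·rp : Kmax ≤ (σ₁ ∸ w) ℕ.* rp
      Kmax≤Z·rp = begin
        Kmax                                              ≡⟨ regroup q r U qr p∸m (p ℕ.* q) ⟩
        U ℕ.* qr ℕ.+ ((p ℕ.* q ℕ.+ q) ℕ.+ (r ℕ.+ p∸m))    ≤⟨ ℕ.+-monoʳ-≤ (U ℕ.* qr) (ℕ.+-mono-≤ (pq+q≤qr p q r p<r)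
                                                               r+p∸m≤pr) ⟩
        U ℕ.* qr ℕ.+ (qr ℕ.+ p ℕ.* r)                    ≡⟨ fold U q r p ⟩
        ((U ℕ.+ 1) ℕ.* q ℕ.+ p) ℕ.* r                     ≤⟨ ℕ.*-monoˡ-≤ r margin ⟩
        p ℕ.* (σ₁ ∸ w) ℕ.* r                              ≡⟨ swap p (σ₁ ∸ w) r ⟩
        (σ₁ ∸ w) ℕ.* rp                                   ∎
        where
        open ℕ.≤-Reasoning
        regroup : ∀ q r U k l b → q ℕ.+ r ℕ.+ (U ℕ.* k ℕ.+ l) ℕ.+ b ≡ U ℕ.* k ℕ.+ ((b ℕ.+ q) ℕ.+ (r ℕ.+ l))
        regroup = NatSolver.solve-∀
        fold : ∀ U q r p → U ℕ.* (q ℕ.* r) ℕ.+ (q ℕ.* r ℕ.+ p ℕ.* r) ≡ ((U ℕ.+ 1) ℕ.* q ℕ.+ p) ℕ.* r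
        fold = NatSolver.solve-∀
        swap : ∀ p z r → p ℕ.* z ℕ.* r ≡ z ℕ.* (r ℕ.* p)
        swap = NatSolver.solve-∀
        r+p∸m≤pr : r ℕ.+ p∸m ≤ p ℕ.* r
        r+p∸m≤pr = ℕ.≤-trans (ℕ.+-monoʳ-≤ r (ℕ.m∸n≤m p m))
                             (ℕ.≤-trans (ℕ.≤-reflexive (ℕ.+-comm r p)) (p+r≤pr p r (ℕ.<⇒≤ 2<p) (ℕ.<⇒≤ 2<r)))

    w≤q : p∸m ℕ.* t ≤ q
    w≤q = ℕ.<⇒≤ p∸m·t<q

    large-Y-below : q ≤ 2 ℕ.* σ → LargeY ((+ 0 + + Zlow) - + r * + v)
    large-Y-below q≤2σ = large-Y σ [U+2]q≤pσ+1 σ+mt≤q y≡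
      where
      w = p∸m ℕ.* t
      [U+1]q≤pσ : (U ℕ.+ 1) ℕ.* q ≤ p ℕ.* σ
      [U+1]q≤pσ = ℕ.*-cancelˡ-≤ 2 $ begin
        2 ℕ.* ((U ℕ.+ 1) ℕ.* q)             ≡⟨ double (U ℕ.+ 1) q ⟩
        ((U ℕ.+ 1) ℕ.+ (U ℕ.+ 1)) ℕ.* q     ≤⟨ ℕ.*-monoˡ-≤ q 2[U+1]≤p ⟩
        p ℕ.* q                             ≤⟨ ℕ.*-monoʳ-≤ p q≤2σ ⟩
        p ℕ.* (2 ℕ.* σ)                     ≡⟨ swap p σ ⟩
        2 ℕ.* (p ℕ.* σ)                     ∎
        where
        open ℕ.≤-Reasoning
        double : ∀ a q → 2 ℕ.* (a ℕ.* q) ≡ (a ℕ.+ a) ℕ.* q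
        double = NatSolver.solve-∀
        swap : ∀ p σ → p ℕ.* (2 ℕ.* σ) ≡ 2 ℕ.* (p ℕ.* σ)
        swap = NatSolver.solve-∀
      [U+2]q≤pσ+1 : (U ℕ.+ 2) ℕ.* q ≤ p ℕ.* σ ℕ.+ 1
      [U+2]q≤pσ+1 = subst (λ a → a ℕ.* q ≤ p ℕ.* σ ℕ.+ 1) (sym (ℕ.+-suc U 1))
        (multiple-above (U ℕ.+ 1) q∣pσ+1 (subst ((U ℕ.+ 1) ℕ.* q <_) (ℕ.+-comm 1 (p ℕ.* σ)) (s≤s [U+1]q≤pσ)))
      σ+mt≤q : σ ℕ.+ m ℕ.* t ≤ q
      σ+mt≤q = ℕ.≤-trans (ℕ.<⇒≤ (ℕ.+-monoʳ-< σ mt<q∸σ)) (ℕ.≤-reflexive (ℕ.m+[n∸m]≡n (ℕ.<⇒≤ σ<q)))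
        where
        mt<q∸σ : m ℕ.* t < q ∸ σ
        mt<q∸σ = ℕ.*-cancelˡ-< p (m ℕ.* t) (q ∸ σ) (ℕ.<-≤-trans p·mt<q (ℕ.≤-trans q≤p[q∸σ]∸1 (ℕ.m∸n≤m _ 1)))
      y≡ : w ≤ σ → (+ 0 + + Zlow) - + r * + v ≡ + (σ ∸ w) mod q
      y≡ w≤σ = ≡mod $ begin
        + q                                                     ∣⟨ ∣m∣n⇒∣m+n (_≡_mod_.∣-difference rt≡σ) (∣n⇒∣m*n (+ 1 - + r) (∣-refl {+ q})) ⟩
        (+ r * + t - + σ) + (+ 1 - + r) * + q                   ≡⟨ cong (λ z → (+ r * + t - + σ) + (+ 1 - + r) * z) (sym v+t≡q) ⟩
        (+ r * + t - + σ) + (+ 1 - + r) * (+ v + + t)           ≡⟨ rearrange (+ r) (+ t) (+ σ) (+ v) (+ w) ⟩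
        ((+ 0 + ((+ v + + t) - + w)) - + r * + v) - (+ σ - + w) ≡⟨ cong₂ (λ a b → ((+ 0 + (a - + w)) - + r * + v) - b) v+t≡q (sym (pos-∸ w≤σ)) ⟩
        ((+ 0 + (+ q - + w)) - + r * + v) - + (σ ∸ w)           ≡⟨ cong (λ a → ((+ 0 + a) - + r * + v) - + (σ ∸ w)) (sym (pos-∸ w≤q)) ⟩
        ((+ 0 + + Zlow) - + r * + v) - + (σ ∸ w)                ∎
        where
        open ∣-Reasoning
        rearrange : ∀ r t σ v w → (r * t - σ) + (+ 1 - r) * (v + t) ≡ ((+ 0 + ((v + t) - w)) - r * v) - (σ - w)
        rearrange = solve-∀

    large-Y-above : 2 ℕ.* σ < q → LargeY ((+ r * + v + + Zlow) - + 0)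
    large-Y-above 2σ<q = large-Y σ₁ [U+2]q≤pσ₁+1 σ₁+mt≤q y≡
      where
      w  = p∸m ℕ.* t
      σ₁ = q ∸ σ
      σ+σ₁≡q : σ ℕ.+ σ₁ ≡ q
      σ+σ₁≡q = ℕ.m+[n∸m]≡n (ℕ.<⇒≤ σ<q)
      q+1≤2σ₁ : q ℕ.+ 1 ≤ 2 ℕ.* σ₁
      q+1≤2σ₁ = ℕ.+-cancelˡ-≤ σ _ _ $ begin
        σ ℕ.+ (q ℕ.+ 1)          ≡⟨ cong (λ x → σ ℕ.+ (x ℕ.+ 1)) (sym σ+σ₁≡q) ⟩
        σ ℕ.+ (σ ℕ.+ σ₁ ℕ.+ 1)   ≡⟨ regroup σ σ₁ ⟩
        (2 ℕ.* σ ℕ.+ 1) ℕ.+ σ₁   ≤⟨ ℕ.+-monoˡ-≤ σ₁ (subst (_≤ q) (ℕ.+-comm 1 (2 ℕ.* σ)) 2σ<q) ⟩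
        q ℕ.+ σ₁                 ≡⟨ cong (ℕ._+ σ₁) (sym σ+σ₁≡q) ⟩
        σ ℕ.+ σ₁ ℕ.+ σ₁          ≡⟨ regroup′ σ σ₁ ⟩
        σ ℕ.+ 2 ℕ.* σ₁           ∎
        where
        open ℕ.≤-Reasoning
        regroup : ∀ σ σ₁ → σ ℕ.+ (σ ℕ.+ σ₁ ℕ.+ 1) ≡ (2 ℕ.* σ ℕ.+ 1) ℕ.+ σ₁
        regroup = NatSolver.solve-∀
        regroup′ : ∀ σ σ₁ → σ ℕ.+ σ₁ ℕ.+ σ₁ ≡ σ ℕ.+ 2 ℕ.* σ₁
        regroup′ = NatSolver.solve-∀
      2[U+1]q+4≤pq+p : ((U ℕ.+ 1) ℕ.+ (U ℕ.+ 1)) ℕ.* q ℕ.+ 4 ≤ p ℕ.* q ℕ.+ p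
      2[U+1]q+4≤pq+p = go U 2[U+1]≤p U+3≤p
        where
        go : ∀ U → (U ℕ.+ 1) ℕ.+ (U ℕ.+ 1) ≤ p → U ℕ.+ 3 ≤ p → ((U ℕ.+ 1) ℕ.+ (U ℕ.+ 1)) ℕ.* q ℕ.+ 4 ≤ p ℕ.* q ℕ.+ p
        go zero    _         3≤p = begin
          (1 ℕ.+ 1) ℕ.* q ℕ.+ 4      ≡⟨ expand₁ q ⟩
          2 ℕ.* q ℕ.+ 1 ℕ.+ 3        ≤⟨ ℕ.+-monoˡ-≤ 3 (ℕ.+-monoʳ-≤ (2 ℕ.* q) 1≤q) ⟩
          2 ℕ.* q ℕ.+ q ℕ.+ 3        ≡⟨ expand₂ q ⟩
          3 ℕ.* q ℕ.+ 3              ≤⟨ ℕ.+-mono-≤ (ℕ.*-monoˡ-≤ q 3≤p) 3≤p ⟩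
          p ℕ.* q ℕ.+ p              ∎
          where
          open ℕ.≤-Reasoning
          expand₁ : ∀ q → (1 ℕ.+ 1) ℕ.* q ℕ.+ 4 ≡ 2 ℕ.* q ℕ.+ 1 ℕ.+ 3
          expand₁ = NatSolver.solve-∀
          expand₂ : ∀ q → 2 ℕ.* q ℕ.+ q ℕ.+ 3 ≡ 3 ℕ.* q ℕ.+ 3
          expand₂ = NatSolver.solve-∀
        go (suc U) 2[U+1]≤p U+3≤p = ℕ.+-mono-≤ (ℕ.*-monoˡ-≤ q 2[U+1]≤p) (ℕ.≤-trans (s≤s (ℕ.m≤n+m 3 U)) U+3≤p)
      [U+1]q+2≤pσ₁ : (U ℕ.+ 1) ℕ.* q ℕ.+ 2 ≤ p ℕ.* σ₁
      [U+1]q+2≤pσ₁ = ℕ.*-cancelˡ-≤ 2 $ begin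
        2 ℕ.* ((U ℕ.+ 1) ℕ.* q ℕ.+ 2)            ≡⟨ double (U ℕ.+ 1) q ⟩
        ((U ℕ.+ 1) ℕ.+ (U ℕ.+ 1)) ℕ.* q ℕ.+ 4    ≤⟨ 2[U+1]q+4≤pq+p ⟩
        p ℕ.* q ℕ.+ p                            ≡⟨ distrib p q ⟩
        p ℕ.* (q ℕ.+ 1)                          ≤⟨ ℕ.*-monoʳ-≤ p q+1≤2σ₁ ⟩
        p ℕ.* (2 ℕ.* σ₁)                         ≡⟨ swap p σ₁ ⟩
        2 ℕ.* (p ℕ.* σ₁)                         ∎
        where
        open ℕ.≤-Reasoning
        double : ∀ a q → 2 ℕ.* (a ℕ.* q ℕ.+ 2) ≡ (a ℕ.+ a) ℕ.* q ℕ.+ 4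
        double = NatSolver.solve-∀
        distrib : ∀ p q → p ℕ.* q ℕ.+ p ≡ p ℕ.* (q ℕ.+ 1)
        distrib = NatSolver.solve-∀
        swap : ∀ p σ → p ℕ.* (2 ℕ.* σ) ≡ 2 ℕ.* (p ℕ.* σ)
        swap = NatSolver.solve-∀
      [U+2]q≤pσ₁+1 : (U ℕ.+ 2) ℕ.* q ≤ p ℕ.* σ₁ ℕ.+ 1
      [U+2]q≤pσ₁+1 = subst (λ a → a ℕ.* q ≤ p ℕ.* σ₁ ℕ.+ 1) (sym (ℕ.+-suc U 1))
        (ℕ.≤-trans (multiple-above (U ℕ.+ 1) q∣p[q∸σ]∸1
                     (ℕ.m+n≤o⇒m≤o∸n (suc ((U ℕ.+ 1) ℕ.* q)) (subst (_≤ p ℕ.* σ₁) (shuffle ((U ℕ.+ 1) ℕ.* q)) [U+1]q+2≤pσ₁)))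
                   (ℕ.≤-trans (ℕ.m∸n≤m _ 1) (ℕ.m≤m+n _ 1)))
        where
        shuffle : ∀ a → a ℕ.+ 2 ≡ suc a ℕ.+ 1
        shuffle = NatSolver.solve-∀
      σ₁+mt≤q : σ₁ ℕ.+ m ℕ.* t ≤ q
      σ₁+mt≤q = ℕ.≤-trans (ℕ.+-monoʳ-≤ σ₁ mt≤σ) (ℕ.≤-reflexive (trans (ℕ.+-comm σ₁ σ) σ+σ₁≡q))
        where
        mt≤σ : m ℕ.* t ≤ σ
        mt≤σ = ℕ.*-cancelˡ-≤ p {{ℕ.>-nonZero 1≤p}} (ℕ.+-cancelʳ-≤ 1 _ _ (ℕ.≤-trans (subst (_≤ q) (ℕ.+-comm 1 _) p·mt<q) q≤pσ+1))
      y≡ : w ≤ σ₁ → (+ r * + v + + Zlow) - + 0 ≡ + (σ₁ ∸ w) mod q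
      y≡ w≤σ₁ = ≡mod $ begin
        + q                                                  ∣⟨ ∣m∣n⇒∣m+n (∣m⇒∣-m (_≡_mod_.∣-difference rt≡σ)) (∣n⇒∣m*n (+ r) (∣-refl {+ q})) ⟩
        - (+ r * + t - + σ) + + r * + q                      ≡⟨ cong (λ z → - (+ r * + t - + σ) + + r * z) (sym v+t≡q) ⟩
        - (+ r * + t - + σ) + + r * (+ v + + t)              ≡⟨ rearrange (+ r) (+ t) (+ σ) (+ v) (+ w) ⟩
        (+ r * + v + ((+ v + + t) - + w) - + 0) - (((+ v + + t) - + σ) - + w)
                                                             ≡⟨ cong (λ a → (+ r * + v + (a - + w) - + 0) - ((a - + σ) - + w)) v+t≡q ⟩
        (+ r * + v + (+ q - + w) - + 0) - ((+ q - + σ) - + w) ≡⟨ cong₂ (λ a b → (+ r * + v + a - + 0) - b) (sym (pos-∸ w≤q))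
                                                                 (trans (cong (_- + w) (sym (pos-∸ (ℕ.<⇒≤ σ<q)))) (sym (pos-∸ w≤σ₁))) ⟩
        (+ r * + v + + Zlow - + 0) - + (σ₁ ∸ w)              ∎
        where
        open ∣-Reasoning
        rearrange : ∀ r t σ v w → - (r * t - σ) + r * (v + t) ≡ (r * v + ((v + t) - w) - + 0) - (((v + t) - σ) - w)
        rearrange = solve-∀

    ±m∈A : InA p q r (+ m) × InA p q r (- + m)
    ±m∈A with q ℕ.≤? 2 ℕ.* σ
    ... | yes q≤2σ = +m∈A-below (large-Y-below q≤2σ) , -m∈A-below (large-Y-below q≤2σ)
    ... | no  q≰2σ = +m∈A-above (large-Y-above (ℕ.≰⇒> q≰2σ)) , -m∈A-above (large-Y-above (ℕ.≰⇒> q≰2σ))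

open import Data.Nat using (ℕ; _<_; _≤_; _*_; _+_; _∸_; _⊓_)
open import Data.Integer using (ℤ; +_; ∣_∣)

private
  pos-*₃ : ∀ a b c → + (a * (b * c)) ≡ + a ℤ.* (+ b ℤ.* + c)
  pos-*₃ a b c = trans (ℤ.pos-* a (b * c)) (cong (+ a ℤ.*_) (ℤ.pos-* b c))

  IsRep-expand : ∀ {p q r n x y z δ} → IsRep p q r n x y z δ →
    n ≡ + x ℤ.* (+ q ℤ.* + r) ℤ.+ + y ℤ.* (+ p ℤ.* + r) ℤ.+ + z ℤ.* (+ p ℤ.* + q) ℤ.+ δ ℤ.* (+ p ℤ.* (+ q ℤ.* + r))
  IsRep-expand {p} {q} {r} {x = x} {y} {z} {δ} (_ , _ , _ , n≡) =
    trans n≡ (cong₂ ℤ._+_ (cong₂ ℤ._+_ (cong₂ ℤ._+_ (pos-*₃ x q r) (pos-*₃ y p r)) (pos-*₃ z p q))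
                          (cong (δ ℤ.*_) (trans (cong +_ (ℕ.*-assoc p q r)) (pos-*₃ p q r))))

IsX⇒≡ : ∀ {p q r n x} → IsX p q r n x → x < p × n ≡ + x ℤ.* + (q * r) mod p
IsX⇒≡ {p} {q} {r} {n} {x} (y , z , δ , rep@(x<p , _)) = x<p , ≡mod (divides (+ y ℤ.* + r ℤ.+ + z ℤ.* + q ℤ.+ δ ℤ.* (+ q ℤ.* + r)) $ begin
  n ℤ.- + x ℤ.* + (q * r)
    ≡⟨ cong₂ (λ a b → a ℤ.- + x ℤ.* b) (IsRep-expand {p} {q} {r} {n} {x} {y} {z} {δ} rep) (ℤ.pos-* q r) ⟩
  (+ x ℤ.* (+ q ℤ.* + r) ℤ.+ + y ℤ.* (+ p ℤ.* + r) ℤ.+ + z ℤ.* (+ p ℤ.* + q) ℤ.+ δ ℤ.* (+ p ℤ.* (+ q ℤ.* + r)))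
    ℤ.- + x ℤ.* (+ q ℤ.* + r)                                   ≡⟨ factor (+ x) (+ y) (+ z) δ (+ p) (+ q) (+ r) ⟩
  (+ y ℤ.* + r ℤ.+ + z ℤ.* + q ℤ.+ δ ℤ.* (+ q ℤ.* + r)) ℤ.* + p ∎)
  where
  open ≡-Reasoning
  factor : ∀ x y z δ p q r →
    (x ℤ.* (q ℤ.* r) ℤ.+ y ℤ.* (p ℤ.* r) ℤ.+ z ℤ.* (p ℤ.* q) ℤ.+ δ ℤ.* (p ℤ.* (q ℤ.* r))) ℤ.- x ℤ.* (q ℤ.* r)
      ≡ (y ℤ.* r ℤ.+ z ℤ.* q ℤ.+ δ ℤ.* (q ℤ.* r)) ℤ.* p
  factor = solve-∀

IsY⇒≡ : ∀ {p q r n y} → IsY p q r n y → y < q × n ≡ + y ℤ.* + (r * p) mod q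
IsY⇒≡ {p} {q} {r} {n} {y} (x , z , δ , rep@(_ , y<q , _)) = y<q , ≡mod (divides (+ x ℤ.* + r ℤ.+ + z ℤ.* + p ℤ.+ δ ℤ.* (+ p ℤ.* + r)) $ begin
  n ℤ.- + y ℤ.* + (r * p)
    ≡⟨ cong₂ (λ a b → a ℤ.- + y ℤ.* b) (IsRep-expand {p} {q} {r} {n} {x} {y} {z} {δ} rep) (ℤ.pos-* r p) ⟩
  (+ x ℤ.* (+ q ℤ.* + r) ℤ.+ + y ℤ.* (+ p ℤ.* + r) ℤ.+ + z ℤ.* (+ p ℤ.* + q) ℤ.+ δ ℤ.* (+ p ℤ.* (+ q ℤ.* + r)))
    ℤ.- + y ℤ.* (+ r ℤ.* + p)                                   ≡⟨ factor (+ x) (+ y) (+ z) δ (+ p) (+ q) (+ r) ⟩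
  (+ x ℤ.* + r ℤ.+ + z ℤ.* + p ℤ.+ δ ℤ.* (+ p ℤ.* + r)) ℤ.* + q ∎)
  where
  open ≡-Reasoning
  factor : ∀ x y z δ p q r →
    (x ℤ.* (q ℤ.* r) ℤ.+ y ℤ.* (p ℤ.* r) ℤ.+ z ℤ.* (p ℤ.* q) ℤ.+ δ ℤ.* (p ℤ.* (q ℤ.* r))) ℤ.- y ℤ.* (r ℤ.* p)
      ≡ (x ℤ.* r ℤ.+ z ℤ.* p ℤ.+ δ ℤ.* (p ℤ.* r)) ℤ.* q
  factor = solve-∀

≤floorDiv⇒ : ∀ {m μ u} → 1 ≤ m → m ≤ floorDiv μ u → 1 ≤ u × m * u ≤ μ
≤floorDiv⇒ {u = zero}  1≤m m≤0 = contradiction (ℕ.≤-trans 1≤m m≤0) λ ()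
≤floorDiv⇒ {m} {μ} {suc u} _ m≤μ/u = s≤s z≤n , ℕ.≤-trans (ℕ.*-monoˡ-≤ (suc u) m≤μ/u) (ℕ.m/n*n≤m μ (suc u))

[q∸v]p²<q : ∀ p {q v} → v < q → q * (p * p) < v * (p * p) + q → (q ∸ v) * (p * p) < q
[q∸v]p²<q p {q} {v} v<q qp²<vp²+q = ℕ.+-cancelˡ-< (v * (p * p)) _ _ (subst (_< v * (p * p) + q) split qp²<vp²+q)
  where
  split : q * (p * p) ≡ v * (p * p) + (q ∸ v) * (p * p)
  split = trans (cong (_* (p * p)) (sym (ℕ.m+[n∸m]≡n (ℕ.<⇒≤ v<q)))) (ℕ.*-distribʳ-+ (p * p) v (q ∸ v))

coprime-≤⇒< : ∀ {p r} → 1 < p → Coprime r p → p ≤ r → p < r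
coprime-≤⇒< {p} {r} 1<p r⊥p p≤r = ℕ.≤∧≢⇒< p≤r λ p≡r →
  ℕ.<⇒≢ 1<p (sym (r⊥p (subst (ℕ._∣ r) (sym p≡r) ℕ.∣-refl , ℕ.∣-refl)))

proposition5 : (p q r : ℕ) → 2 < p → 2 < q → 2 < r →
    Coprime p q → Coprime q r → Coprime r p →
    p ≤ q → p ≤ r →
    (u v xq xr : ℕ) →
    IsX p q r (+ 1) u → IsY p q r (+ 1) v →
    IsX p q r (+ q) xq → IsX p q r (+ r) xr →
    let μ = xq ⊓ xr ⊓ (p ∸ xq) ⊓ (p ∸ xr)
        C = floorDiv μ u
    in u ≤ μ →
       p * p < q →
       q * (p * p) < v * (p * p) + q →
       (n : ℤ) → ∣ n ∣ ≤ C → InA p q r n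
proposition5 p q r 2<p 2<q 2<r p⊥q q⊥r r⊥p _ p≤r u v xq xr 1≡u·qr 1≡v·rp q≡xq·qr r≡xr·qr _ _ qp²<vp²+q = ∈A
  where
  v<q = proj₁ (IsY⇒≡ 1≡v·rp)
  open Construction p q r 2<p 2<q 2<r p⊥q q⊥r r⊥p (coprime-≤⇒< (ℕ.<⇒≤ 2<p) r⊥p p≤r)
                    u v v<q (proj₂ (IsX⇒≡ 1≡u·qr)) (proj₂ (IsY⇒≡ 1≡v·rp)) ([q∸v]p²<q p v<q qp²<vp²+q)
                    xq xr (proj₁ (IsX⇒≡ q≡xq·qr)) (proj₂ (IsX⇒≡ q≡xq·qr)) (proj₂ (IsX⇒≡ r≡xr·qr))
  ±m∈A : ∀ m → suc m ≤ floorDiv (xq ⊓ xr ⊓ (p ∸ xq) ⊓ (p ∸ xr)) u → InA p q r (+ suc m) × InA p q r (ℤ.- + suc m)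
  ±m∈A m m≤C with ≤floorDiv⇒ (s≤s z≤n) m≤C
  ... | 1≤u , m·u≤μ = Target.±m∈A (suc m) (s≤s z≤n) 1≤u
                        (ℕ.≤-trans m·u≤μ (ℕ.≤-trans (ℕ.m⊓n≤m _ _) (ℕ.≤-trans (ℕ.m⊓n≤m _ _) (ℕ.m⊓n≤m _ _))))
                        (ℕ.≤-trans m·u≤μ (ℕ.≤-trans (ℕ.m⊓n≤m _ _) (ℕ.m⊓n≤n _ _)))
  ∈A : (n : ℤ) → ∣ n ∣ ≤ floorDiv (xq ⊓ xr ⊓ (p ∸ xq) ⊓ (p ∸ xr)) u → InA p q r n
  ∈A (+ zero)   _ = 0∈A
  ∈A (+ suc m)  h = proj₁ (±m∈A m h)
  ∈A ℤ.-[1+ m ] h = proj₂ (±m∈A m h)
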